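{- Let $\ell_1$ and $\ell_2$ be primitive binary $\mathbb{Z}$-lattices such that the pair $(\ell_1,\ell_2)$ is not buried in rank $2$. Then the following are equivalent. (i) The pair $(\ell_1,\ell_2)$ is buried in rank $3$. (ii) There exists a positive integer $a$ primitively represented by both $\ell_1$ and $\ell_2$ such that the following open interval contains an integer: $$I_{\ell_1,\ell_2,a}:=\left(\frac{b_1b_2-\sqrt{d\ell_1\, d\ell_2}}{a},\ \frac{b_1b_2+\sqrt{d\ell_1\, d\ell_2}}{a}\right),$$ where $\ell_1\cong\begin{pmatrix} a&b_1\\ b_1&c_1\end{pmatrix}$ and $\ell_2\cong\begin{pmatrix} a&b_2\\ b_2&c_2\end{pmatrix}$ (bases chosen so that the first basis vector has norm $a$).
   Context: Throughout, a $\mathbb{Z}$-lattice means a positive definite integral $\mathbb{Z}$-lattice (a free $\mathbb{Z}$-module with a non-degenerate symmetric bilinear form $B$ with $B(x,y)\in\mathbb{Z}$ and $Q(x)=B(x,x)>0$ for $x\neq 0$); $dL$ denotes the discriminant (determinant of the Gram matrix) of $L$. A lattice $\ell$ is represented by $L$ if there is a linear map $\sigma:\ell\to L$ preserving $B$. For $\mathbb{Z}$-lattices $\ell_1,\ell_2$ of rank $m$, the pair $(\ell_1,\ell_2)$ is said to be buried in rank $n$ if there is a $\mathbb{Z}$-lattice $L$ of rank $n$ representing both $\ell_1$ and $\ell_2$. A $\mathbb{Z}$-lattice $L$ is primitive if there is no integral $\mathbb{Z}$-lattice properly containing $L$ on the quadratic $\mathbb{Q}$-space $\mathbb{Q}L$.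 -}

module Defs where

open import Data.Nat as ℕ using (ℕ; zero; suc)
open import Data.Integer using (ℤ; +_; _+_; _*_; _-_; -_; _<_; ∣_∣; 0ℤ; 1ℤ)
open import Data.Integer.GCD using (gcd)
open import Data.Fin using (Fin; zero; suc)
open import Data.Product using (Σ; ∃; _×_; _,_)
open import Relation.Nullary using (¬_)
open import Relation.Binary.PropositionalEquality using (_≡_; _≢_)
open import Data.Sum using (_⊎_)

Mat : ℕ → ℕ → Set
Mat m n = Fin m → Fin n → ℤ

Σᶠ : (n : ℕ) → (Fin n → ℤ) → ℤ
Σᶠ zero    f = 0ℤ
Σᶠ (suc n) f = f zero + Σᶠ n (λ i → f (suc i))

-- Gram matrix of the images: (Xᵀ G X) i j = Σ_k Σ_l X k i * G k l * X l j
-- (X : Mat n m is the matrix of a linear map ℤ^m → ℤ^n, columns = images of basis vectors)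
congr : {n m : ℕ} → Mat n m → Mat n n → Mat m m
congr {n} X G i j = Σᶠ n (λ k → Σᶠ n (λ l → X k i * (G k l * X l j)))

Qf : {n : ℕ} → Mat n n → (Fin n → ℤ) → ℤ
Qf {n} G x = Σᶠ n (λ k → Σᶠ n (λ l → x k * (G k l * x l)))

_≐_ : {m n : ℕ} → Mat m n → Mat m n → Set
A ≐ B = ∀ i j → A i j ≡ B i j

-- positive definite integral ℤ-lattice of rank n, given by its Gram matrix
-- w.r.t. a basis (integrality: entries in ℤ)
record Lattice (n : ℕ) : Set where
  field
    gram  : Mat n n
    symm  : ∀ i j → gram i j ≡ gram j i
    posdef : (x : Fin n → ℤ) → (∃ λ i → x i ≢ 0ℤ) → 0ℤ < Qf gram x
open Lattice public

Represents : {m n : ℕ} → Lattice m → Lattice n → Set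
Represents {m} {n} ℓ L = Σ (Mat n m) λ X → congr X (gram L) ≐ gram ℓ

BuriedIn : (n : ℕ) → {m : ℕ} → Lattice m → Lattice m → Set
BuriedIn n ℓ₁ ℓ₂ = Σ (Lattice n) λ L → Represents ℓ₁ L × Represents ℓ₂ L

det₂ : Mat 2 2 → ℤ
det₂ A = A zero zero * A (suc zero) (suc zero) - A zero (suc zero) * A (suc zero) zero

disc₂ : Lattice 2 → ℤ
disc₂ ℓ = det₂ (gram ℓ)

-- Primitive (binary case): there is no integral lattice M properly containing L
-- on ℚL.  Such M has a basis f with the basis e of L given by e = f T,
-- T an integer matrix with |det T| > 1 (proper, full-rank inclusion), and its
-- (integral, symmetric) Gram matrix G' satisfies Tᵀ G' T = Gram(L).
Primitive₂ : Lattice 2 → Set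
Primitive₂ L = ¬ (Σ (Mat 2 2) λ G' → Σ (Mat 2 2) λ T →
                 (∀ i j → G' i j ≡ G' j i) × (1 ℕ.< ∣ det₂ T ∣) × (congr T G' ≐ gram L))

bin : ℤ → ℤ → ℤ → Mat 2 2
bin a b c zero zero = a
bin a b c zero (suc zero) = b
bin a b c (suc zero) zero = b
bin a b c (suc zero) (suc zero) = c

IsoBin : Lattice 2 → ℤ → ℤ → ℤ → Set
IsoBin ℓ a b c = Σ (Mat 2 2) λ T → (det₂ T ≡ 1ℤ ⊎ det₂ T ≡ - 1ℤ) × (congr T (gram ℓ) ≐ bin a b c)

PrimRep : Lattice 2 → ℤ → Set
PrimRep ℓ a = Σ ℤ λ x → Σ ℤ λ y → gcd x y ≡ 1ℤ × Qf (gram ℓ) (vec x y) ≡ a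
  where
  vec : ℤ → ℤ → Fin 2 → ℤ
  vec x y zero = x
  vec x y (suc zero) = y

-- Condition (ii).  "I_{ℓ₁,ℓ₂,a} contains an integer z" is written as
-- (a z - b₁ b₂)² < dℓ₁ dℓ₂, equivalent to (b₁b₂-√D)/a < z < (b₁b₂+√D)/a since a > 0.
CondII : Lattice 2 → Lattice 2 → Set
CondII ℓ₁ ℓ₂ =
  Σ ℤ λ a → (0ℤ < a) × PrimRep ℓ₁ a × PrimRep ℓ₂ a ×
    (Σ ℤ λ b₁ → Σ ℤ λ c₁ → Σ ℤ λ b₂ → Σ ℤ λ c₂ →
       IsoBin ℓ₁ a b₁ c₁ × IsoBin ℓ₂ a b₂ c₂ ×
       (Σ ℤ λ z → (a * z - b₁ * b₂) * (a * z - b₁ * b₂) < disc₂ ℓ₁ * disc₂ ℓ₂))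

{-# OPTIONS --safe #-}
-- In L ≅ ℤ³ the images of ℓ₁ and ℓ₂ are the planes spanned by the columns p₁, q₁
-- and p₂, q₂ of the embeddings, with normals N₁ = p₁ × q₁ and N₂ = p₂ × q₂.  Primitivity makes
-- each plane saturated: an integer vector orthogonal to Nᵢ is an integer combination of pᵢ and qᵢ
-- (Cramer's rule writes it with denominator Nᵢ · Nᵢ, and a denominator other than ±1 would give a
-- proper integral overlattice of ℓᵢ).  If N₁ × N₂ = 0 the planes coincide, so ℓ₂ is represented by
-- ℓ₁ and the pair is buried in rank 2.  Otherwise the primitive vector u on the common line of the
-- two planes is primitive in ℓ₁ and in ℓ₂; extending it to bases (u, w₁) and (u, w₂) gives
-- ℓᵢ ≅ (a bᵢ ; bᵢ cᵢ) with a = Q(u), and the Gram matrix (a b₁ b₂ ; b₁ c₁ z ; b₂ z c₂) of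
-- (u, w₁, w₂) is positive definite.  Lagrange's reduction of this ternary form shows that its
-- positivity is exactly (a z - b₁ b₂)² < dℓ₁ dℓ₂, which also gives the converse: under (ii) that
-- matrix is the Gram matrix of a lattice representing both ℓ₁ and ℓ₂.
module Submission where

open import Defs
open import Relation.Nullary using (¬_)
open import Data.Product using (_×_; _,_)

open import Data.Empty using (⊥-elim)
open import Data.Fin using (Fin; zero; suc)
open import Data.Fin.Patterns using (0F; 1F; 2F)
open import Data.Integer as ℤ using (ℤ; +_; +0; +[1+_]; -[1+_]; _+_; _*_; _-_; -_; _<_; _≤_; ∣_∣; 0ℤ; 1ℤ)
import Data.Integer.Properties as ℤP
open import Data.Integer.Tactic.RingSolver using (solve-∀)
import Data.Nat.Properties as ℕP
import Data.Nat.Coprimality as ℕC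
import Data.Nat.DivMod as ℕDM
import Data.Nat.Divisibility as ℕD
import Data.Nat.GCD as ℕG
open import Data.Integer.GCD using (gcd; gcd[i,j]∣i; gcd[i,j]∣j)
import Data.Integer.Divisibility.Signed as ℤD
open import Data.Nat as ℕ using (ℕ)
open import Data.Product using (Σ; ∃; proj₁; proj₂)
import Data.Sum
open import Data.Sum using (_⊎_; inj₁; inj₂)
open import Relation.Nullary using (yes; no)
open import Relation.Binary.PropositionalEquality
open import Function using (_∘_)
open ≡-Reasoning

pos⇒≢0 : ∀ {a} → 0ℤ < a → a ≢ 0ℤ
pos⇒≢0 (ℤ.+<+ ()) refl

sq-nonNeg : ∀ x → 0ℤ ≤ x * x
sq-nonNeg (+ n) rewrite sym (ℤP.pos-* n n) = ℤ.+≤+ ℕ.z≤n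
sq-nonNeg -[1+ n ] = ℤ.+≤+ ℕ.z≤n

sq-pos : ∀ {x} → x ≢ 0ℤ → 0ℤ < x * x
sq-pos {+0}       x≢0 = ⊥-elim (x≢0 refl)
sq-pos {+[1+ n ]} _   = ℤ.+<+ (ℕ.s≤s ℕ.z≤n)
sq-pos { -[1+ n ]} _  = ℤ.+<+ (ℕ.s≤s ℕ.z≤n)

*-pos : ∀ {a b} → 0ℤ < a → 0ℤ < b → 0ℤ < a * b
*-pos {+[1+ m ]} {+[1+ n ]} _ _ = ℤ.+<+ (ℕ.s≤s ℕ.z≤n)
*-pos {+0} (ℤ.+<+ ())
*-pos {+[1+ m ]} {+0} _ (ℤ.+<+ ())

*-nonNeg : ∀ {a b} → 0ℤ ≤ a → 0ℤ ≤ b → 0ℤ ≤ a * b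
*-nonNeg {+ m} {+ n} _ _ rewrite sym (ℤP.pos-* m n) = ℤ.+≤+ ℕ.z≤n

*-pos-cancelˡ : ∀ {a b} → 0ℤ < a → 0ℤ < a * b → 0ℤ < b
*-pos-cancelˡ {+[1+ m ]} {+[1+ n ]} _ _ = ℤ.+<+ (ℕ.s≤s ℕ.z≤n)
*-pos-cancelˡ {+[1+ m ]} {+0} _ ab>0 rewrite ℕP.*-zeroʳ m = ab>0
*-pos-cancelˡ {+[1+ m ]} { -[1+ n ]} _ ()
*-pos-cancelˡ {+0} (ℤ.+<+ ())

<⇒0<- : ∀ {x y} → x < y → 0ℤ < y - x
<⇒0<- {x} {y} x<y = subst (_< y - x) (ℤP.+-inverseʳ x) (ℤP.+-monoˡ-< (- x) x<y)

0<-⇒< : ∀ {x y} → 0ℤ < y - x → x < y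
0<-⇒< {x} {y} 0<y-x = subst₂ _<_ (ℤP.+-identityˡ x) (cancel y x) (ℤP.+-monoˡ-< x 0<y-x)
  where
  cancel : ∀ y x → y - x + x ≡ y
  cancel = solve-∀

private
  term-nonNeg : ∀ {c} → 0ℤ < c → ∀ y → 0ℤ ≤ c * (y * y)
  term-nonNeg c>0 y = *-nonNeg (ℤP.<⇒≤ c>0) (sq-nonNeg y)

  term-pos : ∀ {c y} → 0ℤ < c → y ≢ 0ℤ → 0ℤ < c * (y * y)
  term-pos c>0 y≢0 = *-pos c>0 (sq-pos y≢0)

weighted-squares-pos : ∀ {c₀ c₁ c₂} → 0ℤ < c₀ → 0ℤ < c₁ → 0ℤ < c₂ → (y : Fin 3 → ℤ) → ∃ (λ i → y i ≢ 0ℤ) →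
  0ℤ < c₀ * (y 0F * y 0F) + c₁ * (y 1F * y 1F) + c₂ * (y 2F * y 2F)
weighted-squares-pos c₀>0 c₁>0 c₂>0 y (0F , y₀≢0) =
  ℤP.+-mono-<-≤ (ℤP.+-mono-<-≤ (term-pos c₀>0 y₀≢0) (term-nonNeg c₁>0 (y 1F))) (term-nonNeg c₂>0 (y 2F))
weighted-squares-pos c₀>0 c₁>0 c₂>0 y (1F , y₁≢0) =
  ℤP.+-mono-<-≤ (ℤP.+-mono-≤-< (term-nonNeg c₀>0 (y 0F)) (term-pos c₁>0 y₁≢0)) (term-nonNeg c₂>0 (y 2F))
weighted-squares-pos c₀>0 c₁>0 c₂>0 y (2F , y₂≢0) =
  ℤP.+-mono-≤-< (ℤP.+-mono-≤ (term-nonNeg c₀>0 (y 0F)) (term-nonNeg c₁>0 (y 1F))) (term-pos c₂>0 y₂≢0)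

Unit : ℤ → Set
Unit ε = ε ≡ 1ℤ ⊎ ε ≡ - 1ℤ

Unit-sq : ∀ {ε} → Unit ε → ε * ε ≡ 1ℤ
Unit-sq (inj₁ refl) = refl
Unit-sq (inj₂ refl) = refl

∣ε∣≡1⇒Unit : ∀ {ε} → ∣ ε ∣ ≡ 1 → Unit ε
∣ε∣≡1⇒Unit {+[1+ ℕ.zero ]} refl = inj₁ refl
∣ε∣≡1⇒Unit { -[1+ ℕ.zero ]} refl = inj₂ refl

*-cancelˡ : ∀ {c x y} → c ≢ 0ℤ → c * x ≡ c * y → x ≡ y
*-cancelˡ {c} {x} {y} c≢0 = ℤP.*-cancelˡ-≡ c x y {{ℤ.≢-nonZero c≢0}}

*-cancelˡ-0 : ∀ {c x} → c ≢ 0ℤ → c * x ≡ 0ℤ → x ≡ 0ℤ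
*-cancelˡ-0 {c} c≢0 cx≡0 = *-cancelˡ c≢0 (trans cx≡0 (sym (ℤP.*-zeroʳ c)))

*-≢0 : ∀ {a b} → a ≢ 0ℤ → b ≢ 0ℤ → a * b ≢ 0ℤ
*-≢0 {a} a≢0 b≢0 ab≡0 with ℤP.i*j≡0⇒i≡0∨j≡0 a ab≡0
... | inj₁ a≡0 = a≢0 a≡0
... | inj₂ b≡0 = b≢0 b≡0

Σᶠ-cong : ∀ n {f g : Fin n → ℤ} → (∀ i → f i ≡ g i) → Σᶠ n f ≡ Σᶠ n g
Σᶠ-cong ℕ.zero    f≗g = refl
Σᶠ-cong (ℕ.suc n) f≗g = cong₂ _+_ (f≗g 0F) (Σᶠ-cong n (λ i → f≗g (suc i)))

Σᶠ-zero : ∀ n → Σᶠ n (λ _ → 0ℤ) ≡ 0ℤ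
Σᶠ-zero ℕ.zero    = refl
Σᶠ-zero (ℕ.suc n) = trans (ℤP.+-identityˡ _) (Σᶠ-zero n)

Σᶠ-+ : ∀ n (f g : Fin n → ℤ) → Σᶠ n (λ i → f i + g i) ≡ Σᶠ n f + Σᶠ n g
Σᶠ-+ ℕ.zero    f g = refl
Σᶠ-+ (ℕ.suc n) f g =
  trans (cong (_+_ (f 0F + g 0F)) (Σᶠ-+ n (λ i → f (suc i)) (λ i → g (suc i))))
        (interchange (f 0F) (g 0F) (Σᶠ n (λ i → f (suc i))) (Σᶠ n (λ i → g (suc i))))
  where
  interchange : ∀ a b c d → a + b + (c + d) ≡ a + c + (b + d)
  interchange = solve-∀

Σᶠ-*ˡ : ∀ n c (f : Fin n → ℤ) → c * Σᶠ n f ≡ Σᶠ n (λ i → c * f i)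
Σᶠ-*ˡ ℕ.zero    c f = ℤP.*-zeroʳ c
Σᶠ-*ˡ (ℕ.suc n) c f = trans (ℤP.*-distribˡ-+ c (f 0F) _) (cong (_+_ (c * f 0F)) (Σᶠ-*ˡ n c (λ i → f (suc i))))

Σᶠ-*ʳ : ∀ n c (f : Fin n → ℤ) → Σᶠ n f * c ≡ Σᶠ n (λ i → f i * c)
Σᶠ-*ʳ ℕ.zero    c f = ℤP.*-zeroˡ c
Σᶠ-*ʳ (ℕ.suc n) c f = trans (ℤP.*-distribʳ-+ c (f 0F) _) (cong (_+_ (f 0F * c)) (Σᶠ-*ʳ n c (λ i → f (suc i))))

Σᶠ-swap : ∀ n m (f : Fin n → Fin m → ℤ) →
  Σᶠ n (λ i → Σᶠ m (λ j → f i j)) ≡ Σᶠ m (λ j → Σᶠ n (λ i → f i j))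
Σᶠ-swap ℕ.zero    m f = sym (Σᶠ-zero m)
Σᶠ-swap (ℕ.suc n) m f = trans (cong (_+_ (Σᶠ m (f 0F))) (Σᶠ-swap n m (λ i → f (suc i))))
                              (sym (Σᶠ-+ m (f 0F) (λ j → Σᶠ n (λ i → f (suc i) j))))

Σᶠ-*-Σᶠ : ∀ n m (f : Fin n → ℤ) (g : Fin m → ℤ) → Σᶠ n f * Σᶠ m g ≡ Σᶠ n (λ i → Σᶠ m (λ j → f i * g j))
Σᶠ-*-Σᶠ n m f g = trans (Σᶠ-*ʳ n (Σᶠ m g) f) (Σᶠ-cong n (λ i → Σᶠ-*ˡ m (f i) g))

Σᶠ₂ : (f : Fin 2 → ℤ) → Σᶠ 2 f ≡ f 0F + f 1F
Σᶠ₂ f = cong (_+_ (f 0F)) (ℤP.+-identityʳ (f 1F))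

Σᶠ₃ : (f : Fin 3 → ℤ) → Σᶠ 3 f ≡ f 0F + f 1F + f 2F
Σᶠ₃ f = reassociate (f 0F) (f 1F) (f 2F)
  where
  reassociate : ∀ a b c → a + (b + (c + 0ℤ)) ≡ a + b + c
  reassociate = solve-∀

δ : ∀ {n} → Fin n → Fin n → ℤ
δ zero    zero    = 1ℤ
δ zero    (suc _) = 0ℤ
δ (suc _) zero    = 0ℤ
δ (suc i) (suc j) = δ i j

Σᶠ-δ : ∀ n (i : Fin n) (f : Fin n → ℤ) → Σᶠ n (λ k → δ k i * f k) ≡ f i
Σᶠ-δ (ℕ.suc n) zero f = begin
  1ℤ * f zero + Σᶠ n (λ k → 0ℤ * f (suc k)) ≡⟨ cong₂ _+_ (ℤP.*-identityˡ (f zero)) (Σᶠ-zero n) ⟩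
  f zero + 0ℤ                               ≡⟨ ℤP.+-identityʳ (f zero) ⟩
  f zero                                    ∎
Σᶠ-δ (ℕ.suc n) (suc i) f = trans (ℤP.+-identityˡ _) (Σᶠ-δ n i (λ k → f (suc k)))

infix 4 _≈_
_≈_ : ∀ {n} → (Fin n → ℤ) → (Fin n → ℤ) → Set
x ≈ y = ∀ k → x k ≡ y k

Symmetric : ∀ {n} → Mat n n → Set
Symmetric G = ∀ i j → G i j ≡ G j i

Nonzero : ∀ {n} → (Fin n → ℤ) → Set
Nonzero x = ∃ λ i → x i ≢ 0ℤ

lin : ∀ {n} → ℤ → (Fin n → ℤ) → ℤ → (Fin n → ℤ) → Fin n → ℤ
lin α p β q k = α * p k + β * q k

form : ∀ {n} → Mat n n → (Fin n → ℤ) → (Fin n → ℤ) → ℤ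
form {n} G x y = Σᶠ n (λ k → Σᶠ n (λ l → x k * (G k l * y l)))

col : ∀ {n m} → Mat n m → Fin m → Fin n → ℤ
col X i k = X k i

infixl 25 _*ᵥ_ _*ₘ_

_*ᵥ_ : ∀ {n m} → Mat n m → (Fin m → ℤ) → Fin n → ℤ
_*ᵥ_ {m = m} X y k = Σᶠ m (λ a → X k a * y a)

_*ₘ_ : ∀ {n m p} → Mat n m → Mat m p → Mat n p
_*ₘ_ {m = m} X Y k j = Σᶠ m (λ a → X k a * Y a j)

form₂ : (G : Mat 2 2) (x y : Fin 2 → ℤ) →
  form G x y ≡ x 0F * (G 0F 0F * y 0F + G 0F 1F * y 1F) + x 1F * (G 1F 0F * y 0F + G 1F 1F * y 1F)
form₂ G x y = trans (Σᶠ-cong 2 (λ k → trans (Σᶠ₂ (λ l → x k * (G k l * y l))) (sym (ℤP.*-distribˡ-+ (x k) _ _))))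
                    (Σᶠ₂ (λ k → x k * (G k 0F * y 0F + G k 1F * y 1F)))

form₃ : (G : Mat 3 3) (x y : Fin 3 → ℤ) →
  form G x y ≡ x 0F * (G 0F 0F * y 0F + G 0F 1F * y 1F + G 0F 2F * y 2F) + x 1F * (G 1F 0F * y 0F + G 1F 1F * y 1F + G 1F 2F * y 2F)
             + x 2F * (G 2F 0F * y 0F + G 2F 1F * y 1F + G 2F 2F * y 2F)
form₃ G x y = trans (Σᶠ-cong 3 (λ k → trans (Σᶠ₃ (λ l → x k * (G k l * y l))) (sym (distrib (x k) _ _ _))))
                    (Σᶠ₃ (λ k → x k * (G k 0F * y 0F + G k 1F * y 1F + G k 2F * y 2F)))
  where
  distrib : ∀ a p q r → a * (p + q + r) ≡ a * p + a * q + a * r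
  distrib = solve-∀

form-cong : ∀ {n} {G H : Mat n n} {x x′ y y′ : Fin n → ℤ} → G ≐ H → x ≈ x′ → y ≈ y′ → form G x y ≡ form H x′ y′
form-cong {n} G≐H x≈x′ y≈y′ =
  Σᶠ-cong n (λ k → Σᶠ-cong n (λ l → cong₂ _*_ (x≈x′ k) (cong₂ _*_ (G≐H k l) (y≈y′ l))))

form-sym : ∀ {n} {G : Mat n n} → Symmetric G → ∀ x y → form G x y ≡ form G y x
form-sym {n} {G} G-sym x y = trans (Σᶠ-swap n n _) (Σᶠ-cong n (λ l → Σᶠ-cong n (λ k → begin
  x k * (G k l * y l) ≡⟨ cong (λ g → x k * (g * y l)) (G-sym k l) ⟩
  x k * (G l k * y l) ≡⟨ swap (x k) (G l k) (y l) ⟩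
  y l * (G l k * x k) ∎)))
  where
  swap : ∀ a b c → a * (b * c) ≡ c * (b * a)
  swap = solve-∀

form-*ᵥ : ∀ {n m} (G : Mat n n) (X : Mat n m) (y w : Fin m → ℤ) →
  form G (X *ᵥ y) (X *ᵥ w) ≡ form (congr X G) y w
form-*ᵥ {n} {m} G X y w = begin
  form G (X *ᵥ y) (X *ᵥ w)
    ≡⟨ Σᶠ-cong n (λ k → Σᶠ-cong n (λ l → expand k l)) ⟩
  Σᶠ n (λ k → Σᶠ n (λ l → Σᶠ m (λ a → Σᶠ m (λ b → term k l a b))))
    ≡⟨ Σᶠ-cong n (λ k → Σᶠ-swap n m (λ l a → Σᶠ m (term k l a))) ⟩
  Σᶠ n (λ k → Σᶠ m (λ a → Σᶠ n (λ l → Σᶠ m (term k l a))))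
    ≡⟨ Σᶠ-cong n (λ k → Σᶠ-cong m (λ a → Σᶠ-swap n m (λ l b → term k l a b))) ⟩
  Σᶠ n (λ k → Σᶠ m (λ a → Σᶠ m (λ b → Σᶠ n (λ l → term k l a b))))
    ≡⟨ Σᶠ-swap n m (λ k a → Σᶠ m (λ b → Σᶠ n (λ l → term k l a b))) ⟩
  Σᶠ m (λ a → Σᶠ n (λ k → Σᶠ m (λ b → Σᶠ n (λ l → term k l a b))))
    ≡⟨ Σᶠ-cong m (λ a → Σᶠ-swap n m (λ k b → Σᶠ n (λ l → term k l a b))) ⟩
  Σᶠ m (λ a → Σᶠ m (λ b → Σᶠ n (λ k → Σᶠ n (λ l → term k l a b))))
    ≡⟨ Σᶠ-cong m (λ a → Σᶠ-cong m (λ b → factor a b)) ⟩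
  form (congr X G) y w ∎
  where
  regroup : ∀ xa ya g xb wb → xa * ya * (g * (xb * wb)) ≡ ya * (xa * (g * xb) * wb)
  regroup = solve-∀

  term : Fin n → Fin n → Fin m → Fin m → ℤ
  term k l a b = y a * (X k a * (G k l * X l b) * w b)

  expand : ∀ k l → (X *ᵥ y) k * (G k l * (X *ᵥ w) l) ≡ Σᶠ m (λ a → Σᶠ m (λ b → term k l a b))
  expand k l = begin
    (X *ᵥ y) k * (G k l * (X *ᵥ w) l)
      ≡⟨ cong ((X *ᵥ y) k *_) (Σᶠ-*ˡ m (G k l) (λ b → X l b * w b)) ⟩
    (X *ᵥ y) k * Σᶠ m (λ b → G k l * (X l b * w b))
      ≡⟨ Σᶠ-*-Σᶠ m m (λ a → X k a * y a) (λ b → G k l * (X l b * w b)) ⟩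
    Σᶠ m (λ a → Σᶠ m (λ b → X k a * y a * (G k l * (X l b * w b))))
      ≡⟨ Σᶠ-cong m (λ a → Σᶠ-cong m (λ b → regroup (X k a) (y a) (G k l) (X l b) (w b))) ⟩
    Σᶠ m (λ a → Σᶠ m (λ b → term k l a b)) ∎

  factor : ∀ a b → Σᶠ n (λ k → Σᶠ n (λ l → term k l a b)) ≡ y a * (congr X G a b * w b)
  factor a b = sym (begin
    y a * (congr X G a b * w b)
      ≡⟨ cong (y a *_) (trans (Σᶠ-*ʳ n (w b) _) (Σᶠ-cong n (λ k → Σᶠ-*ʳ n (w b) _))) ⟩
    y a * Σᶠ n (λ k → Σᶠ n (λ l → X k a * (G k l * X l b) * w b))
      ≡⟨ trans (Σᶠ-*ˡ n (y a) _) (Σᶠ-cong n (λ k → Σᶠ-*ˡ n (y a) _)) ⟩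
    Σᶠ n (λ k → Σᶠ n (λ l → term k l a b)) ∎)

congr-*ₘ : ∀ {n m p} (G : Mat n n) (X : Mat n m) (Y : Mat m p) → congr Y (congr X G) ≐ congr (X *ₘ Y) G
congr-*ₘ G X Y i j = sym (form-*ᵥ G X (col Y i) (col Y j))

congr-cong : ∀ {n m} {G H : Mat n n} {X Y : Mat n m} → G ≐ H → X ≐ Y → congr X G ≐ congr Y H
congr-cong G≐H X≐Y i j = form-cong G≐H (λ k → X≐Y k i) (λ k → X≐Y k j)

congr-sym : ∀ {n m} {G : Mat n n} → Symmetric G → (X : Mat n m) → Symmetric (congr X G)
congr-sym G-sym X i j = form-sym G-sym (col X i) (col X j)

congr-factor : ∀ {n m p} {G : Mat n n} {H₁ : Mat m m} {H₂ : Mat p p} {X₁ : Mat n m} {X₂ : Mat n p} (Y : Mat m p) →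
  X₁ *ₘ Y ≐ X₂ → congr X₁ G ≐ H₁ → congr X₂ G ≐ H₂ → congr Y H₁ ≐ H₂
congr-factor {G = G} {H₁} {H₂} {X₁} {X₂} Y X₁Y≐X₂ e₁ e₂ i j = begin
  congr Y H₁ i j           ≡⟨ congr-cong {G = H₁} {X = Y} {Y = Y} (λ a b → sym (e₁ a b)) (λ _ _ → refl) i j ⟩
  congr Y (congr X₁ G) i j ≡⟨ congr-*ₘ G X₁ Y i j ⟩
  congr (X₁ *ₘ Y) G i j    ≡⟨ congr-cong {G = G} {H = G} (λ _ _ → refl) X₁Y≐X₂ i j ⟩
  congr X₂ G i j           ≡⟨ e₂ i j ⟩
  H₂ i j                   ∎

embed : ∀ {m n} → (Fin m → Fin n) → Mat n m
embed e k i = δ k (e i)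

congr-embed : ∀ {m n} (e : Fin m → Fin n) (G : Mat n n) → congr (embed e) G ≐ λ i j → G (e i) (e j)
congr-embed {n = n} e G i j = begin
  Σᶠ n (λ k → Σᶠ n (λ l → δ k (e i) * (G k l * δ l (e j))))
    ≡⟨ Σᶠ-cong n (λ k → sym (Σᶠ-*ˡ n (δ k (e i)) (λ l → G k l * δ l (e j)))) ⟩
  Σᶠ n (λ k → δ k (e i) * Σᶠ n (λ l → G k l * δ l (e j)))
    ≡⟨ Σᶠ-cong n (λ k → cong (δ k (e i) *_) (trans (Σᶠ-cong n (λ l → ℤP.*-comm (G k l) (δ l (e j)))) (Σᶠ-δ n (e j) (G k)))) ⟩
  Σᶠ n (λ k → δ k (e i) * G k (e j))
    ≡⟨ Σᶠ-δ n (e i) (λ k → G k (e j)) ⟩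
  G (e i) (e j) ∎

pick₂ : ∀ {n} → Fin n → Fin n → Fin 2 → Fin n
pick₂ i j 0F = i
pick₂ i j 1F = j

congr-pick₂ : ∀ {n} {G : Mat n n} → Symmetric G → (i j : Fin n) → congr (embed (pick₂ i j)) G ≐ bin (G i i) (G i j) (G j j)
congr-pick₂ {G = G} G-sym i j k l = trans (congr-embed (pick₂ i j) G k l) (entry k l)
  where
  entry : ∀ k l → G (pick₂ i j k) (pick₂ i j l) ≡ bin (G i i) (G i j) (G j j) k l
  entry 0F 0F = refl
  entry 0F 1F = refl
  entry 1F 0F = G-sym j i
  entry 1F 1F = refl

GramRep : ∀ {m n} → Mat m m → Mat n n → Set
GramRep {m} {n} H G = Σ (Mat n m) λ X → congr X G ≐ H

GramRep-trans : ∀ {m k n} {H : Mat m m} {K : Mat k k} {G : Mat n n} → GramRep H K → GramRep K G → GramRep H G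
GramRep-trans {G = G} (Y , eY) (X , eX) = X *ₘ Y , λ i j →
  trans (sym (congr-*ₘ G X Y i j)) (trans (congr-cong {G = congr X G} {X = Y} {Y = Y} eX (λ _ _ → refl) i j) (eY i j))

vec₂ : ℤ → ℤ → Fin 2 → ℤ
vec₂ x y 0F = x
vec₂ x y 1F = y

vec₃ : ℤ → ℤ → ℤ → Fin 3 → ℤ
vec₃ x y z 0F = x
vec₃ x y z 1F = y
vec₃ x y z 2F = z

cols₂ : ∀ {n} → (Fin n → ℤ) → (Fin n → ℤ) → Mat n 2
cols₂ u w k 0F = u k
cols₂ u w k 1F = w k

cols₃ : ∀ {n} → (Fin n → ℤ) → (Fin n → ℤ) → (Fin n → ℤ) → Mat n 3
cols₃ u w₁ w₂ k 0F = u k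
cols₃ u w₁ w₂ k 1F = w₁ k
cols₃ u w₁ w₂ k 2F = w₂ k

mat₂ : ℤ → ℤ → ℤ → ℤ → Mat 2 2
mat₂ a b c d = cols₂ (vec₂ a c) (vec₂ b d)

I₂ : Mat 2 2
I₂ = embed (λ i → i)

tern : ℤ → ℤ → ℤ → ℤ → ℤ → ℤ → Mat 3 3
tern a b₁ b₂ c₁ z c₂ = cols₃ (vec₃ a b₁ b₂) (vec₃ b₁ c₁ z) (vec₃ b₂ z c₂)

tern-sym : ∀ a b₁ b₂ c₁ z c₂ → Symmetric (tern a b₁ b₂ c₁ z c₂)
tern-sym a b₁ b₂ c₁ z c₂ 0F 0F = refl
tern-sym a b₁ b₂ c₁ z c₂ 0F 1F = refl
tern-sym a b₁ b₂ c₁ z c₂ 0F 2F = refl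
tern-sym a b₁ b₂ c₁ z c₂ 1F 0F = refl
tern-sym a b₁ b₂ c₁ z c₂ 1F 1F = refl
tern-sym a b₁ b₂ c₁ z c₂ 1F 2F = refl
tern-sym a b₁ b₂ c₁ z c₂ 2F 0F = refl
tern-sym a b₁ b₂ c₁ z c₂ 2F 1F = refl
tern-sym a b₁ b₂ c₁ z c₂ 2F 2F = refl

gram-cols₂ : ∀ {n} {G : Mat n n} → Symmetric G → (u w : Fin n → ℤ) →
  congr (cols₂ u w) G ≐ bin (form G u u) (form G u w) (form G w w)
gram-cols₂ G-sym u w 0F 0F = refl
gram-cols₂ G-sym u w 0F 1F = refl
gram-cols₂ G-sym u w 1F 0F = form-sym G-sym w u
gram-cols₂ G-sym u w 1F 1F = refl

gram-cols₃ : ∀ {n} {G : Mat n n} → Symmetric G → (u w₁ w₂ : Fin n → ℤ) →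
  congr (cols₃ u w₁ w₂) G ≐ tern (form G u u) (form G u w₁) (form G u w₂) (form G w₁ w₁) (form G w₁ w₂) (form G w₂ w₂)
gram-cols₃ G-sym u w₁ w₂ 0F 0F = refl
gram-cols₃ G-sym u w₁ w₂ 0F 1F = refl
gram-cols₃ G-sym u w₁ w₂ 0F 2F = refl
gram-cols₃ G-sym u w₁ w₂ 1F 0F = form-sym G-sym w₁ u
gram-cols₃ G-sym u w₁ w₂ 1F 1F = refl
gram-cols₃ G-sym u w₁ w₂ 1F 2F = refl
gram-cols₃ G-sym u w₁ w₂ 2F 0F = form-sym G-sym w₂ u
gram-cols₃ G-sym u w₁ w₂ 2F 1F = form-sym G-sym w₂ w₁
gram-cols₃ G-sym u w₁ w₂ 2F 2F = refl

*ₘ-mat₂ : ∀ {n} (X : Mat n 2) a b c d k →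
  (X *ₘ mat₂ a b c d) k 0F ≡ lin a (col X 0F) c (col X 1F) k × (X *ₘ mat₂ a b c d) k 1F ≡ lin b (col X 0F) d (col X 1F) k
*ₘ-mat₂ X a b c d k = column (X k 0F) (X k 1F) a c , column (X k 0F) (X k 1F) b d
  where
  column : ∀ x y a c → x * a + (y * c + 0ℤ) ≡ a * x + c * y
  column = solve-∀

det₂-cong : ∀ {A B : Mat 2 2} → A ≐ B → det₂ A ≡ det₂ B
det₂-cong A≐B = cong₂ _-_ (cong₂ _*_ (A≐B 0F 0F) (A≐B 1F 1F))
                          (cong₂ _*_ (A≐B 0F 1F) (A≐B 1F 0F))

det₂-congr : (T H : Mat 2 2) → det₂ (congr T H) ≡ det₂ T * det₂ T * det₂ H
det₂-congr T H = trans (det₂-cong (λ i j → form₂ H (col T i) (col T j)))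
                       (identity (T 0F 0F) (T 0F 1F) (T 1F 0F) (T 1F 1F) (H 0F 0F) (H 0F 1F) (H 1F 0F) (H 1F 1F))
  where
  identity : ∀ a b c d h₀₀ h₀₁ h₁₀ h₁₁ →
    let x₀₀ = a * (h₀₀ * a + h₀₁ * c) + c * (h₁₀ * a + h₁₁ * c)
        x₀₁ = a * (h₀₀ * b + h₀₁ * d) + c * (h₁₀ * b + h₁₁ * d)
        x₁₀ = b * (h₀₀ * a + h₀₁ * c) + d * (h₁₀ * a + h₁₁ * c)
        x₁₁ = b * (h₀₀ * b + h₀₁ * d) + d * (h₁₀ * b + h₁₁ * d)
    in x₀₀ * x₁₁ - x₀₁ * x₁₀ ≡ (a * d - b * c) * (a * d - b * c) * (h₀₀ * h₁₁ - h₀₁ * h₁₀)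
  identity = solve-∀

-- For a unimodular T, det T · adj T is the inverse matrix.
inv₂ : Mat 2 2 → Mat 2 2
inv₂ T = mat₂ (d * T 1F 1F) (d * - T 0F 1F) (d * - T 1F 0F) (d * T 0F 0F)
  where d = det₂ T

*ₘ-inv₂ : (T : Mat 2 2) → Unit (det₂ T) → T *ₘ inv₂ T ≐ I₂
*ₘ-inv₂ T unit k j = begin
  (T *ₘ inv₂ T) k j             ≡⟨ scaled k j ⟩
  (det₂ T * det₂ T) * I₂ k j    ≡⟨ cong (_* I₂ k j) (Unit-sq unit) ⟩
  1ℤ * I₂ k j                   ≡⟨ ℤP.*-identityˡ (I₂ k j) ⟩
  I₂ k j                        ∎
  where
  a = T 0F 0F
  b = T 0F 1F
  c = T 1F 0F
  e = T 1F 1F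
  scaled : ∀ k j → (T *ₘ inv₂ T) k j ≡ (det₂ T * det₂ T) * I₂ k j
  scaled 0F 0F = entry₀₀ a b c e
    where
    entry₀₀ : ∀ a b c e → let d = a * e - b * c in a * (d * e) + (b * (d * - c) + 0ℤ) ≡ d * d * 1ℤ
    entry₀₀ = solve-∀
  scaled 0F 1F = entry₀₁ a b c e
    where
    entry₀₁ : ∀ a b c e → let d = a * e - b * c in a * (d * - b) + (b * (d * a) + 0ℤ) ≡ d * d * 0ℤ
    entry₀₁ = solve-∀
  scaled 1F 0F = entry₁₀ a b c e
    where
    entry₁₀ : ∀ a b c e → let d = a * e - b * c in c * (d * e) + (e * (d * - c) + 0ℤ) ≡ d * d * 0ℤ
    entry₁₀ = solve-∀
  scaled 1F 1F = entry₁₁ a b c e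
    where
    entry₁₁ : ∀ a b c e → let d = a * e - b * c in c * (d * - b) + (e * (d * a) + 0ℤ) ≡ d * d * 1ℤ
    entry₁₁ = solve-∀

IsoBin⇒disc : ∀ {ℓ a b c} → IsoBin ℓ a b c → a * c - b * b ≡ disc₂ ℓ
IsoBin⇒disc {ℓ} {a} {b} {c} (T , unit , T-iso) = begin
  det₂ (bin a b c)                  ≡⟨ det₂-cong (λ i j → sym (T-iso i j)) ⟩
  det₂ (congr T (gram ℓ))           ≡⟨ det₂-congr T (gram ℓ) ⟩
  det₂ T * det₂ T * disc₂ ℓ         ≡⟨ cong (_* disc₂ ℓ) (Unit-sq unit) ⟩
  1ℤ * disc₂ ℓ                      ≡⟨ ℤP.*-identityˡ (disc₂ ℓ) ⟩
  disc₂ ℓ                           ∎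

IsoBin⇒GramRep : ∀ {ℓ a b c} → IsoBin ℓ a b c → GramRep (gram ℓ) (bin a b c)
IsoBin⇒GramRep {ℓ} (T , unit , T-iso) =
  inv₂ T , congr-factor {G = gram ℓ} {X₁ = T} (inv₂ T) (*ₘ-inv₂ T unit) T-iso (congr-embed (λ i → i) (gram ℓ))

disc-pos : (ℓ : Lattice 2) → 0ℤ < disc₂ ℓ
disc-pos ℓ = *-pos-cancelˡ a>0 (subst (0ℤ <_) Q[-b,a] (posdef ℓ (vec₂ (- G 0F 1F) (G 0F 0F)) (1F , pos⇒≢0 a>0)))
  where
  G = gram ℓ
  Q[1,0] : Qf G (vec₂ 1ℤ 0ℤ) ≡ G 0F 0F
  Q[1,0] = trans (form₂ G (vec₂ 1ℤ 0ℤ) (vec₂ 1ℤ 0ℤ)) (evaluate (G 0F 0F) (G 0F 1F) (G 1F 0F) (G 1F 1F))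
    where
    evaluate : ∀ g₀₀ g₀₁ g₁₀ g₁₁ → 1ℤ * (g₀₀ * 1ℤ + g₀₁ * 0ℤ) + 0ℤ * (g₁₀ * 1ℤ + g₁₁ * 0ℤ) ≡ g₀₀
    evaluate = solve-∀
  a>0 : 0ℤ < G 0F 0F
  a>0 = subst (0ℤ <_) Q[1,0] (posdef ℓ (vec₂ 1ℤ 0ℤ) (0F , λ ()))
  Q[-b,a] : Qf G (vec₂ (- G 0F 1F) (G 0F 0F)) ≡ G 0F 0F * disc₂ ℓ
  Q[-b,a] = trans (form₂ G (vec₂ (- G 0F 1F) (G 0F 0F)) (vec₂ (- G 0F 1F) (G 0F 0F)))
                  (evaluate (G 0F 0F) (G 0F 1F) (G 1F 0F) (G 1F 1F))
    where
    evaluate : ∀ g₀₀ g₀₁ g₁₀ g₁₁ →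
      - g₀₁ * (g₀₀ * - g₀₁ + g₀₁ * g₀₀) + g₀₀ * (g₁₀ * - g₀₁ + g₁₁ * g₀₀) ≡ g₀₀ * (g₀₀ * g₁₁ - g₀₁ * g₁₀)
    evaluate = solve-∀

-- Δ is a · det (tern a b₁ b₂ c₁ z c₂), and 0 < Δ is the inequality in condition (ii).
Δ : ℤ → ℤ → ℤ → ℤ → ℤ → ℤ → ℤ
Δ a b₁ b₂ c₁ z c₂ = (a * c₁ - b₁ * b₁) * (a * c₂ - b₂ * b₂) - (a * z - b₁ * b₂) * (a * z - b₁ * b₂)

nonzero-first : (x : Fin 3 → ℤ) → ∃ (λ i → x i ≢ 0ℤ) → x 1F ≡ 0ℤ → x 2F ≡ 0ℤ → x 0F ≢ 0ℤ
nonzero-first x (0F , x₀≢0) x₁≡0 x₂≡0 = x₀≢0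
nonzero-first x (1F , x₁≢0) x₁≡0 x₂≡0 = ⊥-elim (x₁≢0 x₁≡0)
nonzero-first x (2F , x₂≢0) x₁≡0 x₂≡0 = ⊥-elim (x₂≢0 x₂≡0)

-- Lagrange's reduction of the ternary form with matrix (a b₁ b₂ ; b₁ c₁ z ; b₂ z c₂).
completed-square : ∀ a b₁ b₂ c₁ z c₂ x₀ x₁ x₂ →
  let d = a * c₁ - b₁ * b₁
      e = a * z - b₁ * b₂
      Q = x₀ * (a * x₀ + b₁ * x₁ + b₂ * x₂) + x₁ * (b₁ * x₀ + c₁ * x₁ + z * x₂) + x₂ * (b₂ * x₀ + z * x₁ + c₂ * x₂)
  in a * d * Q ≡ d * ((a * x₀ + b₁ * x₁ + b₂ * x₂) * (a * x₀ + b₁ * x₁ + b₂ * x₂)) + 1ℤ * ((d * x₁ + e * x₂) * (d * x₁ + e * x₂))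
                 + (d * (a * c₂ - b₂ * b₂) - e * e) * (x₂ * x₂)
completed-square = solve-∀

module _ (a b₁ b₂ c₁ z c₂ : ℤ) where

  private
    d e : ℤ
    d = a * c₁ - b₁ * b₁
    e = a * z - b₁ * b₂

  lagrange : (Fin 3 → ℤ) → Fin 3 → ℤ
  lagrange x = vec₃ (a * x 0F + b₁ * x 1F + b₂ * x 2F)
                    (d * x 1F + e * x 2F)
                    (x 2F)

  tern-completed-square : ∀ x → let y = lagrange x in
    a * d * Qf (tern a b₁ b₂ c₁ z c₂) x ≡ d * (y 0F * y 0F) + 1ℤ * (y 1F * y 1F) + Δ a b₁ b₂ c₁ z c₂ * (y 2F * y 2F)
  tern-completed-square x =
    trans (cong (a * d *_) (form₃ (tern a b₁ b₂ c₁ z c₂) x x)) (completed-square a b₁ b₂ c₁ z c₂ (x 0F) (x 1F) (x 2F))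

  private
    padding : ∀ p q → p + q * 0ℤ ≡ p
    padding p q = trans (cong (_+_ p) (ℤP.*-zeroʳ q)) (ℤP.+-identityʳ p)

  lagrange-nonzero : a ≢ 0ℤ → a * c₁ - b₁ * b₁ ≢ 0ℤ → ∀ x → ∃ (λ i → x i ≢ 0ℤ) → ∃ (λ i → lagrange x i ≢ 0ℤ)
  lagrange-nonzero a≢0 d≢0 x x≢0 with x 2F ℤ.≟ 0ℤ | x 1F ℤ.≟ 0ℤ
  ... | no x₂≢0  | _        = 2F , x₂≢0
  ... | yes x₂≡0 | no x₁≢0  = 1F , λ y₁≡0 → x₁≢0 (*-cancelˡ-0 d≢0 (begin
    d * x 1F                  ≡⟨ sym (padding (d * x 1F) e) ⟩
    d * x 1F + e * 0ℤ         ≡⟨ cong (λ t → d * x 1F + e * t) (sym x₂≡0) ⟩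
    d * x 1F + e * x 2F       ≡⟨ y₁≡0 ⟩
    0ℤ                        ∎))
  ... | yes x₂≡0 | yes x₁≡0 = 0F , λ y₀≡0 → nonzero-first x x≢0 x₁≡0 x₂≡0 (*-cancelˡ-0 a≢0 (begin
    a * x 0F                       ≡⟨ sym (padding (a * x 0F) b₁) ⟩
    a * x 0F + b₁ * 0ℤ             ≡⟨ sym (padding (a * x 0F + b₁ * 0ℤ) b₂) ⟩
    a * x 0F + b₁ * 0ℤ + b₂ * 0ℤ   ≡⟨ cong₂ (λ s t → a * x 0F + b₁ * s + b₂ * t) (sym x₁≡0) (sym x₂≡0) ⟩
    lagrange x 0F                  ≡⟨ y₀≡0 ⟩
    0ℤ                             ∎))

  tern-posdef : 0ℤ < a → 0ℤ < a * c₁ - b₁ * b₁ → 0ℤ < Δ a b₁ b₂ c₁ z c₂ →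
    ∀ x → ∃ (λ i → x i ≢ 0ℤ) → 0ℤ < Qf (tern a b₁ b₂ c₁ z c₂) x
  tern-posdef a>0 d>0 Δ>0 x x≢0 = *-pos-cancelˡ (*-pos a>0 d>0) (subst (0ℤ <_) (sym (tern-completed-square x))
    (weighted-squares-pos {c₁ = 1ℤ} d>0 (ℤ.+<+ (ℕ.s≤s ℕ.z≤n)) Δ>0 (lagrange x)
                          (lagrange-nonzero (pos⇒≢0 a>0) (pos⇒≢0 d>0) x x≢0)))

  -- The vector on which the first two squares of the reduction vanish.
  witness : Fin 3 → ℤ
  witness = vec₃ (b₁ * e - b₂ * d) (- (a * e)) (a * d)

  lagrange-witness : lagrange witness ≈ vec₃ 0ℤ 0ℤ (a * d)
  lagrange-witness 0F = cancel a b₁ b₂ d e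
    where
    cancel : ∀ a b₁ b₂ d e → a * (b₁ * e - b₂ * d) + b₁ * - (a * e) + b₂ * (a * d) ≡ 0ℤ
    cancel = solve-∀
  lagrange-witness 1F = cancel a d e
    where
    cancel : ∀ a d e → d * - (a * e) + e * (a * d) ≡ 0ℤ
    cancel = solve-∀
  lagrange-witness 2F = refl

  Δ-pos : 0ℤ < a → 0ℤ < a * c₁ - b₁ * b₁ → 0ℤ < Qf (tern a b₁ b₂ c₁ z c₂) witness → 0ℤ < Δ a b₁ b₂ c₁ z c₂
  Δ-pos a>0 d>0 Q>0 = *-pos-cancelˡ (sq-pos (pos⇒≢0 ad>0)) (subst (0ℤ <_) reduced (*-pos ad>0 Q>0))
    where
    ad>0 : 0ℤ < a * d
    ad>0 = *-pos a>0 d>0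
    D = Δ a b₁ b₂ c₁ z c₂
    y = lagrange witness
    reduced : a * d * Qf (tern a b₁ b₂ c₁ z c₂) witness ≡ a * d * (a * d) * D
    reduced = begin
      a * d * Qf (tern a b₁ b₂ c₁ z c₂) witness
        ≡⟨ tern-completed-square witness ⟩
      d * (y 0F * y 0F) + 1ℤ * (y 1F * y 1F) + D * (a * d * (a * d))
        ≡⟨ cong₂ (λ s t → d * (s * s) + 1ℤ * (t * t) + D * (a * d * (a * d)))
                 (lagrange-witness 0F) (lagrange-witness 1F) ⟩
      d * 0ℤ + 0ℤ + D * (a * d * (a * d))
        ≡⟨ cong (λ t → t + 0ℤ + D * (a * d * (a * d))) (ℤP.*-zeroʳ d) ⟩
      0ℤ + D * (a * d * (a * d))
        ≡⟨ ℤP.+-identityˡ _ ⟩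
      D * (a * d * (a * d))
        ≡⟨ ℤP.*-comm D _ ⟩
      a * d * (a * d) * D ∎

Bezout : ℤ → ℤ → Set
Bezout α β = Σ ℤ λ s → Σ ℤ λ t → s * α + t * β ≡ 1ℤ

Bezout⇒gcd≡1 : ∀ {α β} → Bezout α β → gcd α β ≡ 1ℤ
Bezout⇒gcd≡1 {α} {β} (s , t , bez) = cong +_ (ℕD.∣1⇒≡1 (ℤD.∣⇒∣ᵤ gcd∣1))
  where
  gcd∣1 : gcd α β ℤD.∣ 1ℤ
  gcd∣1 = subst (gcd α β ℤD.∣_) bez (ℤD.∣m∣n⇒∣m+n (ℤD.∣n⇒∣m*n s (ℤD.∣ᵤ⇒∣ (gcd[i,j]∣i α β)))
                                                   (ℤD.∣n⇒∣m*n t (ℤD.∣ᵤ⇒∣ (gcd[i,j]∣j α β))))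

sign-decomposition : ∀ A → Σ ℤ λ ε → Unit ε × A ≡ ε * + ∣ A ∣
sign-decomposition (+ n)    = 1ℤ , inj₁ refl , sym (ℤP.*-identityˡ (+ n))
sign-decomposition -[1+ n ] = - 1ℤ , inj₂ refl , sym (ℤP.-1*i≡-i (+ ℕ.suc n))

signed-bezout : ∀ {ε δ} → Unit ε → Unit δ → ∀ x m y n → 1 ℕ.+ y ℕ.* n ≡ x ℕ.* m →
  ε * + x * (ε * + m) + - (δ * + y) * (δ * + n) ≡ 1ℤ
signed-bezout {ε} {δ} uε uδ x m y n 1+yn≡xm = begin
  ε * + x * (ε * + m) + - (δ * + y) * (δ * + n) ≡⟨ regroup ε (+ x) (+ m) δ (+ y) (+ n) ⟩
  ε * ε * (+ x * + m) - δ * δ * (+ y * + n)     ≡⟨ cong₂ (λ s t → s * (+ x * + m) - t * (+ y * + n)) (Unit-sq uε) (Unit-sq uδ) ⟩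
  1ℤ * (+ x * + m) - 1ℤ * (+ y * + n)           ≡⟨ cong₂ (λ s t → 1ℤ * s - 1ℤ * t) (sym (ℤP.pos-* x m)) (sym (ℤP.pos-* y n)) ⟩
  1ℤ * + (x ℕ.* m) - 1ℤ * + (y ℕ.* n)           ≡⟨ cong (λ k → 1ℤ * + k - 1ℤ * + (y ℕ.* n)) (sym 1+yn≡xm) ⟩
  1ℤ * + (1 ℕ.+ y ℕ.* n) - 1ℤ * + (y ℕ.* n)     ≡⟨ cong (λ k → 1ℤ * k - 1ℤ * + (y ℕ.* n)) (ℤP.pos-+ 1 (y ℕ.* n)) ⟩
  1ℤ * (1ℤ + + (y ℕ.* n)) - 1ℤ * + (y ℕ.* n)    ≡⟨ cancel (+ (y ℕ.* n)) ⟩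
  1ℤ                                            ∎
  where
  regroup : ∀ ε x m δ y n → ε * x * (ε * m) + - (δ * y) * (δ * n) ≡ ε * ε * (x * m) - δ * δ * (y * n)
  regroup = solve-∀
  cancel : ∀ k → 1ℤ * (1ℤ + k) - 1ℤ * k ≡ 1ℤ
  cancel = solve-∀

CoprimeSplit : ℤ → ℤ → Set
CoprimeSplit A B = Σ ℤ λ g → Σ ℤ λ α → Σ ℤ λ β → Bezout α β × g ≢ 0ℤ × A ≡ g * α × B ≡ g * β

coprime-split : ∀ A B → A ≢ 0ℤ ⊎ B ≢ 0ℤ → CoprimeSplit A B
coprime-split A B A,B≢0 = + d , εA * + m′ , εB * + n′ , bezout , d≢0 , split A m′ εA A≡ m′*d≡m , split B n′ εB B≡ n′*d≡n
  where
  m n d : ℕ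
  m = ∣ A ∣
  n = ∣ B ∣
  d = ℕG.gcd m n
  d≢0ℕ : d ≢ 0
  d≢0ℕ = ℕG.gcd[m,n]≢0 m n (Data.Sum.map (λ A≢0 → A≢0 ∘ ℤP.∣i∣≡0⇒i≡0) (λ B≢0 → B≢0 ∘ ℤP.∣i∣≡0⇒i≡0) A,B≢0)
  instance
    _ : ℕ.NonZero d
    _ = ℕ.≢-nonZero d≢0ℕ
  d≢0 : + d ≢ 0ℤ
  d≢0 = d≢0ℕ ∘ ℤP.+-injective
  m′ n′ : ℕ
  m′ = m ℕDM./ d
  n′ = n ℕDM./ d
  m′*d≡m : m′ ℕ.* d ≡ m
  m′*d≡m = ℕDM.m/n*n≡m (ℕG.gcd[m,n]∣m m n)
  n′*d≡n : n′ ℕ.* d ≡ n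
  n′*d≡n = ℕDM.m/n*n≡m (ℕG.gcd[m,n]∣n m n)
  εA = proj₁ (sign-decomposition A)
  εB = proj₁ (sign-decomposition B)
  uA = proj₁ (proj₂ (sign-decomposition A))
  uB = proj₁ (proj₂ (sign-decomposition B))
  A≡ = proj₂ (proj₂ (sign-decomposition A))
  B≡ = proj₂ (proj₂ (sign-decomposition B))
  split : ∀ X k′ ε → X ≡ ε * + ∣ X ∣ → k′ ℕ.* d ≡ ∣ X ∣ → X ≡ + d * (ε * + k′)
  split X k′ ε X≡ k′d≡ = begin
    X                    ≡⟨ X≡ ⟩
    ε * + ∣ X ∣          ≡⟨ cong (λ k → ε * + k) (sym k′d≡) ⟩
    ε * + (k′ ℕ.* d)     ≡⟨ cong (ε *_) (ℤP.pos-* k′ d) ⟩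
    ε * (+ k′ * + d)     ≡⟨ swap ε (+ k′) (+ d) ⟩
    + d * (ε * + k′)     ∎
    where
    swap : ∀ ε k d → ε * (k * d) ≡ d * (ε * k)
    swap = solve-∀
  bezout : Bezout (εA * + m′) (εB * + n′)
  bezout with ℕC.coprime-Bézout (ℕC.coprime-/gcd m n)
  ... | ℕG.Bézout.+- x y 1+yn′≡xm′ = εA * + x , - (εB * + y) , signed-bezout uA uB x m′ y n′ 1+yn′≡xm′
  ... | ℕG.Bézout.-+ x y 1+xm′≡yn′ = - (εA * + x) , εB * + y ,
    trans (ℤP.+-comm (- (εA * + x) * (εA * + m′)) _) (signed-bezout uB uA y n′ x m′ 1+xm′≡yn′)

zero-pair? : ∀ A B → (A ≡ 0ℤ × B ≡ 0ℤ) ⊎ (A ≢ 0ℤ ⊎ B ≢ 0ℤ)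
zero-pair? A B with A ℤ.≟ 0ℤ | B ℤ.≟ 0ℤ
... | yes A≡0 | yes B≡0 = inj₁ (A≡0 , B≡0)
... | no A≢0  | _       = inj₂ (inj₁ A≢0)
... | yes _   | no B≢0  = inj₂ (inj₂ B≢0)

V : Set
V = Fin 3 → ℤ

dot : V → V → ℤ
dot a b = a 0F * b 0F + a 1F * b 1F + a 2F * b 2F

cross : V → V → V
cross a b 0F = a 1F * b 2F - a 2F * b 1F
cross a b 1F = a 2F * b 0F - a 0F * b 2F
cross a b 2F = a 0F * b 1F - a 1F * b 0F

dot-cong : ∀ {a a′ b b′} → a ≈ a′ → b ≈ b′ → dot a b ≡ dot a′ b′
dot-cong a≈a′ b≈b′ = cong₂ _+_ (cong₂ _+_ (cong₂ _*_ (a≈a′ 0F) (b≈b′ 0F)) (cong₂ _*_ (a≈a′ 1F) (b≈b′ 1F)))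
                                (cong₂ _*_ (a≈a′ 2F) (b≈b′ 2F))

dot-comm : ∀ a b → dot a b ≡ dot b a
dot-comm a b = cong₂ _+_ (cong₂ _+_ (ℤP.*-comm (a 0F) (b 0F)) (ℤP.*-comm (a 1F) (b 1F))) (ℤP.*-comm (a 2F) (b 2F))

dot-zeroˡ : ∀ {a} b → a ≈ (λ _ → 0ℤ) → dot a b ≡ 0ℤ
dot-zeroˡ b a≈0 = dot-cong {b = b} {b′ = b} a≈0 (λ _ → refl)

form-dot : (G : Mat 3 3) (x y : V) → form G x y ≡ dot x (G *ᵥ y)
form-dot G x y = trans (Σᶠ-cong 3 (λ k → sym (Σᶠ-*ˡ 3 (x k) (λ l → G k l * y l)))) (Σᶠ₃ (λ k → x k * (G *ᵥ y) k))

dot-lin : ∀ x p y q s → dot (lin x p y q) s ≡ x * dot p s + y * dot q s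
dot-lin x p y q s = identity x (p 0F) (p 1F) (p 2F) y (q 0F) (q 1F) (q 2F) (s 0F) (s 1F) (s 2F)
  where
  identity : ∀ x p₀ p₁ p₂ y q₀ q₁ q₂ s₀ s₁ s₂ →
    (x * p₀ + y * q₀) * s₀ + (x * p₁ + y * q₁) * s₁ + (x * p₂ + y * q₂) * s₂
      ≡ x * (p₀ * s₀ + p₁ * s₁ + p₂ * s₂) + y * (q₀ * s₀ + q₁ * s₁ + q₂ * s₂)
  identity = solve-∀

dot-scaleˡ : ∀ h u s → dot (λ k → h * u k) s ≡ h * dot u s
dot-scaleˡ h u s = identity h (u 0F) (u 1F) (u 2F) (s 0F) (s 1F) (s 2F)
  where
  identity : ∀ h u₀ u₁ u₂ s₀ s₁ s₂ → h * u₀ * s₀ + h * u₁ * s₁ + h * u₂ * s₂ ≡ h * (u₀ * s₀ + u₁ * s₁ + u₂ * s₂)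
  identity = solve-∀

cross-cong : ∀ {a a′ b b′} → a ≈ a′ → b ≈ b′ → cross a b ≈ cross a′ b′
cross-cong a≈a′ b≈b′ 0F = cong₂ _-_ (cong₂ _*_ (a≈a′ 1F) (b≈b′ 2F)) (cong₂ _*_ (a≈a′ 2F) (b≈b′ 1F))
cross-cong a≈a′ b≈b′ 1F = cong₂ _-_ (cong₂ _*_ (a≈a′ 2F) (b≈b′ 0F)) (cong₂ _*_ (a≈a′ 0F) (b≈b′ 2F))
cross-cong a≈a′ b≈b′ 2F = cong₂ _-_ (cong₂ _*_ (a≈a′ 0F) (b≈b′ 1F)) (cong₂ _*_ (a≈a′ 1F) (b≈b′ 0F))

-- All three components of the cross product have the shape aᵢ bⱼ - aⱼ bᵢ.
private
  vanish : ∀ x y → x * 0ℤ - y * 0ℤ ≡ 0ℤ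
  vanish = solve-∀

  bilinear : ∀ x y z w pᵢ pⱼ qᵢ qⱼ →
    (x * pᵢ + y * qᵢ) * (z * pⱼ + w * qⱼ) - (x * pⱼ + y * qⱼ) * (z * pᵢ + w * qᵢ) ≡ (x * w - y * z) * (pᵢ * qⱼ - pⱼ * qᵢ)
  bilinear = solve-∀

cross-zeroʳ : ∀ a → cross a (λ _ → 0ℤ) ≈ (λ _ → 0ℤ)
cross-zeroʳ a 0F = vanish (a 1F) (a 2F)
cross-zeroʳ a 1F = vanish (a 2F) (a 0F)
cross-zeroʳ a 2F = vanish (a 0F) (a 1F)

cross-lin : ∀ p q x y z w → cross (lin x p y q) (lin z p w q) ≈ λ k → (x * w - y * z) * cross p q k
cross-lin p q x y z w 0F = bilinear x y z w (p 1F) (p 2F) (q 1F) (q 2F)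
cross-lin p q x y z w 1F = bilinear x y z w (p 2F) (p 0F) (q 2F) (q 0F)
cross-lin p q x y z w 2F = bilinear x y z w (p 0F) (p 1F) (q 0F) (q 1F)

dot-cross-selfˡ : ∀ a b → dot a (cross a b) ≡ 0ℤ
dot-cross-selfˡ a b = identity (a 0F) (a 1F) (a 2F) (b 0F) (b 1F) (b 2F)
  where
  identity : ∀ a₀ a₁ a₂ b₀ b₁ b₂ → a₀ * (a₁ * b₂ - a₂ * b₁) + a₁ * (a₂ * b₀ - a₀ * b₂) + a₂ * (a₀ * b₁ - a₁ * b₀) ≡ 0ℤ
  identity = solve-∀

dot-cross-selfʳ : ∀ a b → dot b (cross a b) ≡ 0ℤ
dot-cross-selfʳ a b = identity (a 0F) (a 1F) (a 2F) (b 0F) (b 1F) (b 2F)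
  where
  identity : ∀ a₀ a₁ a₂ b₀ b₁ b₂ → b₀ * (a₁ * b₂ - a₂ * b₁) + b₁ * (a₂ * b₀ - a₀ * b₂) + b₂ * (a₀ * b₁ - a₁ * b₀) ≡ 0ℤ
  identity = solve-∀

dot-cross-lin : ∀ p q x y → dot (lin x p y q) (cross p q) ≡ 0ℤ
dot-cross-lin p q x y = begin
  dot (lin x p y q) (cross p q)                    ≡⟨ dot-lin x p y q (cross p q) ⟩
  x * dot p (cross p q) + y * dot q (cross p q)    ≡⟨ cong₂ (λ c d → x * c + y * d) (dot-cross-selfˡ p q) (dot-cross-selfʳ p q) ⟩
  x * 0ℤ + y * 0ℤ                                  ≡⟨ cong₂ _+_ (ℤP.*-zeroʳ x) (ℤP.*-zeroʳ y) ⟩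
  0ℤ                                               ∎

dot-cross-cross : ∀ a b c s → dot (cross a (cross b c)) s ≡ dot b s * dot c a - dot c s * dot b a
dot-cross-cross a b c s = identity (a 0F) (a 1F) (a 2F) (b 0F) (b 1F) (b 2F) (c 0F) (c 1F) (c 2F) (s 0F) (s 1F) (s 2F)
  where
  identity : ∀ a₀ a₁ a₂ b₀ b₁ b₂ c₀ c₁ c₂ s₀ s₁ s₂ →
    let m₀ = b₁ * c₂ - b₂ * c₁
        m₁ = b₂ * c₀ - b₀ * c₂
        m₂ = b₀ * c₁ - b₁ * c₀
    in (a₁ * m₂ - a₂ * m₁) * s₀ + (a₂ * m₀ - a₀ * m₂) * s₁ + (a₀ * m₁ - a₁ * m₀) * s₂
         ≡ (b₀ * s₀ + b₁ * s₁ + b₂ * s₂) * (c₀ * a₀ + c₁ * a₁ + c₂ * a₂)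
           - (c₀ * s₀ + c₁ * s₁ + c₂ * s₂) * (b₀ * a₀ + b₁ * a₁ + b₂ * a₂)
  identity = solve-∀

binet-cauchy : ∀ a b c d → dot a c * dot b d - dot a d * dot b c ≡ dot (cross a b) (cross c d)
binet-cauchy a b c d = identity (a 0F) (a 1F) (a 2F) (b 0F) (b 1F) (b 2F) (c 0F) (c 1F) (c 2F) (d 0F) (d 1F) (d 2F)
  where
  identity : ∀ a₀ a₁ a₂ b₀ b₁ b₂ c₀ c₁ c₂ d₀ d₁ d₂ →
    (a₀ * c₀ + a₁ * c₁ + a₂ * c₂) * (b₀ * d₀ + b₁ * d₁ + b₂ * d₂) - (a₀ * d₀ + a₁ * d₁ + a₂ * d₂) * (b₀ * c₀ + b₁ * c₁ + b₂ * c₂)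
      ≡ (a₁ * b₂ - a₂ * b₁) * (c₁ * d₂ - c₂ * d₁) + (a₂ * b₀ - a₀ * b₂) * (c₂ * d₀ - c₀ * d₂)
        + (a₀ * b₁ - a₁ * b₀) * (c₀ * d₁ - c₁ * d₀)
  identity = solve-∀

triple-with-unit : ∀ N u w s → dot u s ≡ 1ℤ → dot u N ≡ 0ℤ → dot (cross N (cross u w)) s ≡ dot w N
triple-with-unit N u w s us≡1 u⊥N = begin
  dot (cross N (cross u w)) s           ≡⟨ dot-cross-cross N u w s ⟩
  dot u s * dot w N - dot w s * dot u N ≡⟨ cong₂ (λ c d → c * dot w N - dot w s * d) us≡1 u⊥N ⟩
  1ℤ * dot w N - dot w s * 0ℤ           ≡⟨ simplify (dot w N) (dot w s) ⟩
  dot w N                               ∎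
  where
  simplify : ∀ x y → 1ℤ * x - y * 0ℤ ≡ x
  simplify = solve-∀

parallel-normals : ∀ a b r → cross a b ≈ (λ _ → 0ℤ) → dot r b ≡ 0ℤ → dot r a * dot b b ≡ 0ℤ
parallel-normals a b r a×b≈0 r⊥b = begin
  dot r a * dot b b                        ≡⟨ cong (_* dot b b) (dot-comm r a) ⟩
  dot a r * dot b b                        ≡⟨ sym (ℤP.+-identityʳ _) ⟩
  dot a r * dot b b - 0ℤ * dot a b         ≡⟨ cong (λ c → dot a r * dot b b - c * dot a b) (sym (trans (dot-comm b r) r⊥b)) ⟩
  dot a r * dot b b - dot b r * dot a b    ≡⟨ sym (dot-cross-cross b a b r) ⟩
  dot (cross b (cross a b)) r              ≡⟨ dot-zeroˡ r (λ k → trans (cross-cong {b} {b} (λ _ → refl) a×b≈0 k) (cross-zeroʳ b k)) ⟩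
  0ℤ                                       ∎

dot-cols₃-⊥ : ∀ u w₁ w₂ x N → dot u N ≡ 0ℤ → dot w₁ N ≡ 0ℤ → dot (cols₃ u w₁ w₂ *ᵥ x) N ≡ x 2F * dot w₂ N
dot-cols₃-⊥ u w₁ w₂ x N u⊥N w₁⊥N = begin
  dot (cols₃ u w₁ w₂ *ᵥ x) N
    ≡⟨ dot-cong {b = N} {b′ = N} (λ k → columns (u k) (w₁ k) (w₂ k) (x 0F) (x 1F) (x 2F)) (λ _ → refl) ⟩
  dot (lin (x 0F) u 1ℤ (lin (x 1F) w₁ (x 2F) w₂)) N
    ≡⟨ dot-lin (x 0F) u 1ℤ (lin (x 1F) w₁ (x 2F) w₂) N ⟩
  x 0F * dot u N + 1ℤ * dot (lin (x 1F) w₁ (x 2F) w₂) N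
    ≡⟨ cong₂ (λ c d → x 0F * c + 1ℤ * d) u⊥N (dot-lin (x 1F) w₁ (x 2F) w₂ N) ⟩
  x 0F * 0ℤ + 1ℤ * (x 1F * dot w₁ N + x 2F * dot w₂ N)
    ≡⟨ cong (λ c → x 0F * 0ℤ + 1ℤ * (x 1F * c + x 2F * dot w₂ N)) w₁⊥N ⟩
  x 0F * 0ℤ + 1ℤ * (x 1F * 0ℤ + x 2F * dot w₂ N)
    ≡⟨ collapse (x 0F) (x 1F) (x 2F) (dot w₂ N) ⟩
  x 2F * dot w₂ N ∎
  where
  columns : ∀ u w₁ w₂ x₀ x₁ x₂ → u * x₀ + (w₁ * x₁ + (w₂ * x₂ + 0ℤ)) ≡ x₀ * u + 1ℤ * (x₁ * w₁ + x₂ * w₂)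
  columns = solve-∀
  collapse : ∀ x₀ x₁ x₂ w → x₀ * 0ℤ + 1ℤ * (x₁ * 0ℤ + x₂ * w) ≡ x₂ * w
  collapse = solve-∀

-- Cramer's rule for the basis p, q, p × q of ℚ³, coordinate by coordinate.
private
  cramer₀ : ∀ p₀ p₁ p₂ q₀ q₁ q₂ r₀ r₁ r₂ →
    let n₀ = p₁ * q₂ - p₂ * q₁ ; n₁ = p₂ * q₀ - p₀ * q₂ ; n₂ = p₀ * q₁ - p₁ * q₀
        A = (r₁ * q₂ - r₂ * q₁) * n₀ + (r₂ * q₀ - r₀ * q₂) * n₁ + (r₀ * q₁ - r₁ * q₀) * n₂
        B = (p₁ * r₂ - p₂ * r₁) * n₀ + (p₂ * r₀ - p₀ * r₂) * n₁ + (p₀ * r₁ - p₁ * r₀) * n₂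
    in (n₀ * n₀ + n₁ * n₁ + n₂ * n₂) * r₀ ≡ A * p₀ + B * q₀ + (r₀ * n₀ + r₁ * n₁ + r₂ * n₂) * n₀
  cramer₀ = solve-∀

  cramer₁ : ∀ p₀ p₁ p₂ q₀ q₁ q₂ r₀ r₁ r₂ →
    let n₀ = p₁ * q₂ - p₂ * q₁ ; n₁ = p₂ * q₀ - p₀ * q₂ ; n₂ = p₀ * q₁ - p₁ * q₀
        A = (r₁ * q₂ - r₂ * q₁) * n₀ + (r₂ * q₀ - r₀ * q₂) * n₁ + (r₀ * q₁ - r₁ * q₀) * n₂
        B = (p₁ * r₂ - p₂ * r₁) * n₀ + (p₂ * r₀ - p₀ * r₂) * n₁ + (p₀ * r₁ - p₁ * r₀) * n₂
    in (n₀ * n₀ + n₁ * n₁ + n₂ * n₂) * r₁ ≡ A * p₁ + B * q₁ + (r₀ * n₀ + r₁ * n₁ + r₂ * n₂) * n₁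
  cramer₁ = solve-∀

  cramer₂ : ∀ p₀ p₁ p₂ q₀ q₁ q₂ r₀ r₁ r₂ →
    let n₀ = p₁ * q₂ - p₂ * q₁ ; n₁ = p₂ * q₀ - p₀ * q₂ ; n₂ = p₀ * q₁ - p₁ * q₀
        A = (r₁ * q₂ - r₂ * q₁) * n₀ + (r₂ * q₀ - r₀ * q₂) * n₁ + (r₀ * q₁ - r₁ * q₀) * n₂
        B = (p₁ * r₂ - p₂ * r₁) * n₀ + (p₂ * r₀ - p₀ * r₂) * n₁ + (p₀ * r₁ - p₁ * r₀) * n₂
    in (n₀ * n₀ + n₁ * n₁ + n₂ * n₂) * r₂ ≡ A * p₂ + B * q₂ + (r₀ * n₀ + r₁ * n₁ + r₂ * n₂) * n₂
  cramer₂ = solve-∀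

cramer : ∀ p q r → let N = cross p q in
  ∀ k → dot N N * r k ≡ lin (dot (cross r q) N) p (dot (cross p r) N) q k + dot r N * N k
cramer p q r 0F = cramer₀ (p 0F) (p 1F) (p 2F) (q 0F) (q 1F) (q 2F) (r 0F) (r 1F) (r 2F)
cramer p q r 1F = cramer₁ (p 0F) (p 1F) (p 2F) (q 0F) (q 1F) (q 2F) (r 0F) (r 1F) (r 2F)
cramer p q r 2F = cramer₂ (p 0F) (p 1F) (p 2F) (q 0F) (q 1F) (q 2F) (r 0F) (r 1F) (r 2F)

nonzero? : (v : V) → Nonzero v ⊎ v ≈ (λ _ → 0ℤ)
nonzero? v with v 0F ℤ.≟ 0ℤ | v 1F ℤ.≟ 0ℤ | v 2F ℤ.≟ 0ℤ
... | no v₀≢0  | _        | _        = inj₁ (0F , v₀≢0)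
... | yes _    | no v₁≢0  | _        = inj₁ (1F , v₁≢0)
... | yes _    | yes _    | no v₂≢0  = inj₁ (2F , v₂≢0)
... | yes v₀≡0 | yes v₁≡0 | yes v₂≡0 = inj₂ λ { 0F → v₀≡0 ; 1F → v₁≡0 ; 2F → v₂≡0 }

dot≢0⇒Nonzero : ∀ a b → dot a b ≢ 0ℤ → Nonzero a
dot≢0⇒Nonzero a b ab≢0 with nonzero? a
... | inj₁ a≢0 = a≢0
... | inj₂ a≈0 = ⊥-elim (ab≢0 (dot-zeroˡ b a≈0))

dot-self-pos : ∀ v → Nonzero v → 0ℤ < dot v v
dot-self-pos v v≢0 = subst (0ℤ <_) (unit-weights (v 0F) (v 1F) (v 2F)) (weighted-squares-pos 0<1 0<1 0<1 v v≢0)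
  where
  unit-weights : ∀ a b c → 1ℤ * (a * a) + 1ℤ * (b * b) + 1ℤ * (c * c) ≡ a * a + b * b + c * c
  unit-weights = solve-∀
  0<1 : 0ℤ < 1ℤ
  0<1 = ℤ.+<+ (ℕ.s≤s ℕ.z≤n)

PrimitivePart : V → Set
PrimitivePart v = Σ ℤ λ h → Σ V λ u → Σ V λ s → h ≢ 0ℤ × v ≈ (λ k → h * u k) × dot u s ≡ 1ℤ

primitive-part : (v : V) → Nonzero v → PrimitivePart v
primitive-part v v≢0 with zero-pair? (v 1F) (v 2F)
... | inj₁ (v₁≡0 , v₂≡0) = v 0F , vec₃ 1ℤ 0ℤ 0ℤ , vec₃ 1ℤ 0ℤ 0ℤ , nonzero-first v v≢0 v₁≡0 v₂≡0 , v≈ , refl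
  where
  v≈ : v ≈ (λ k → v 0F * vec₃ 1ℤ 0ℤ 0ℤ k)
  v≈ 0F = sym (ℤP.*-identityʳ (v 0F))
  v≈ 1F = trans v₁≡0 (sym (ℤP.*-zeroʳ (v 0F)))
  v≈ 2F = trans v₂≡0 (sym (ℤP.*-zeroʳ (v 0F)))
... | inj₂ v₁,v₂≢0 = divide (coprime-split (v 1F) (v 2F) v₁,v₂≢0)
  where
  divide : CoprimeSplit (v 1F) (v 2F) → PrimitivePart v
  divide (g , α , β , (s , t , sα+tβ≡1) , g≢0 , v₁≡gα , v₂≡gβ) = divide′ (coprime-split g (v 0F) (inj₁ g≢0))
    where
    divide′ : CoprimeSplit g (v 0F) → PrimitivePart v
    divide′ (h , g′ , c , (x , y , xg′+yc≡1) , h≢0 , g≡hg′ , v₀≡hc) =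
      h , vec₃ c (g′ * α) (g′ * β) , vec₃ y (x * s) (x * t) , h≢0 , v≈ , bezout
      where
      v≈ : v ≈ (λ k → h * vec₃ c (g′ * α) (g′ * β) k)
      v≈ 0F = v₀≡hc
      v≈ 1F = trans v₁≡gα (trans (cong (_* α) g≡hg′) (ℤP.*-assoc h g′ α))
      v≈ 2F = trans v₂≡gβ (trans (cong (_* β) g≡hg′) (ℤP.*-assoc h g′ β))

      expand : ∀ c g′ α β y x s t → c * y + g′ * α * (x * s) + g′ * β * (x * t) ≡ x * g′ * (s * α + t * β) + y * c
      expand = solve-∀

      bezout : dot (vec₃ c (g′ * α) (g′ * β)) (vec₃ y (x * s) (x * t)) ≡ 1ℤ
      bezout = begin
        dot (vec₃ c (g′ * α) (g′ * β)) (vec₃ y (x * s) (x * t)) ≡⟨ expand c g′ α β y x s t ⟩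
        x * g′ * (s * α + t * β) + y * c                        ≡⟨ cong (λ r → x * g′ * r + y * c) sα+tβ≡1 ⟩
        x * g′ * 1ℤ + y * c                                     ≡⟨ cong (_+ y * c) (ℤP.*-identityʳ (x * g′)) ⟩
        x * g′ + y * c                                          ≡⟨ xg′+yc≡1 ⟩
        1ℤ                                                      ∎

bezout-coordinates : ∀ {u : V} s p q α β → u ≈ lin α p β q → dot u s ≡ 1ℤ → dot p s * α + dot q s * β ≡ 1ℤ
bezout-coordinates {u} s p q α β u≈ us≡1 = begin
  dot p s * α + dot q s * β ≡⟨ cong₂ _+_ (ℤP.*-comm (dot p s) α) (ℤP.*-comm (dot q s) β) ⟩
  α * dot p s + β * dot q s ≡⟨ sym (dot-lin α p β q s) ⟩
  dot (lin α p β q) s       ≡⟨ dot-cong {b = s} {b′ = s} (λ k → sym (u≈ k)) (λ _ → refl) ⟩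
  dot u s                   ≡⟨ us≡1 ⟩
  1ℤ                        ∎

InSpan : ∀ {n} → Mat n 2 → (Fin n → ℤ) → Set
InSpan X r = Σ ℤ λ a → Σ ℤ λ b → r ≈ lin a (col X 0F) b (col X 1F)

module Saturation {n} (ℓ : Lattice 2) {G : Mat n n} (G-sym : Symmetric G)
                  (X : Mat n 2) (X-iso : congr X G ≐ gram ℓ) (prim : Primitive₂ ℓ) where

  private
    p q : Fin n → ℤ
    p = col X 0F
    q = col X 1F

  -- With u = αp + βq and D r = g u, the vectors r′ = y r + x u (so D r′ = u) and w = -t p + s q
  -- span an integral lattice containing ℓ with index |D|, so primitivity of ℓ forces D = ±1.
  denominator-unit : ∀ {r : Fin n → ℤ} {α β D g} → Bezout α β → Bezout D g → D ≢ 0ℤ →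
    (∀ k → D * r k ≡ g * lin α p β q k) → Unit D
  denominator-unit {r} {α} {β} {D} {g} (s , t , sα+tβ≡1) (x , y , xD+yg≡1) D≢0 Dr≡gu with ∣ D ∣ ℕ.≟ 1
  ... | yes ∣D∣≡1 = ∣ε∣≡1⇒Unit ∣D∣≡1
  ... | no ∣D∣≢1  =
    ⊥-elim (prim (congr Y G , T , congr-sym G-sym Y , 1<∣detT∣ , congr-factor {G = G} {X₁ = Y} T YT≐X (λ _ _ → refl) X-iso))
    where
    u w r′ : Fin n → ℤ
    u = lin α p β q
    w = lin (- t) p s q
    r′ k = y * r k + x * u k

    Dr′≡u : ∀ k → D * r′ k ≡ u k
    Dr′≡u k = begin
      D * r′ k                        ≡⟨ distribute D y (r k) x (u k) ⟩
      y * (D * r k) + x * D * u k     ≡⟨ cong (λ v → y * v + x * D * u k) (Dr≡gu k) ⟩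
      y * (g * u k) + x * D * u k     ≡⟨ factor y g (u k) x D ⟩
      (x * D + y * g) * u k           ≡⟨ cong (_* u k) xD+yg≡1 ⟩
      1ℤ * u k                        ≡⟨ ℤP.*-identityˡ (u k) ⟩
      u k                             ∎
      where
      distribute : ∀ D y r x u → D * (y * r + x * u) ≡ y * (D * r) + x * D * u
      distribute = solve-∀
      factor : ∀ y g u x D → y * (g * u) + x * D * u ≡ (x * D + y * g) * u
      factor = solve-∀

    Y : Mat n 2
    Y = cols₂ r′ w

    T : Mat 2 2
    T = mat₂ (s * D) (t * D) (- β) α

    YT≐X : Y *ₘ T ≐ X
    YT≐X k 0F = begin
      (Y *ₘ T) k 0F                   ≡⟨ regroup (r′ k) (w k) s D β ⟩
      s * (D * r′ k) - β * w k        ≡⟨ cong (λ v → s * v - β * w k) (Dr′≡u k) ⟩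
      s * u k - β * w k               ≡⟨ eliminate s α (p k) β (q k) t ⟩
      (s * α + t * β) * p k           ≡⟨ cong (_* p k) sα+tβ≡1 ⟩
      1ℤ * p k                        ≡⟨ ℤP.*-identityˡ (p k) ⟩
      p k                             ∎
      where
      regroup : ∀ r w s D β → r * (s * D) + (w * - β + 0ℤ) ≡ s * (D * r) - β * w
      regroup = solve-∀
      eliminate : ∀ s α p β q t → s * (α * p + β * q) - β * (- t * p + s * q) ≡ (s * α + t * β) * p
      eliminate = solve-∀
    YT≐X k 1F = begin
      (Y *ₘ T) k 1F                   ≡⟨ regroup (r′ k) (w k) t D α ⟩
      t * (D * r′ k) + α * w k        ≡⟨ cong (λ v → t * v + α * w k) (Dr′≡u k) ⟩
      t * u k + α * w k               ≡⟨ eliminate s α (p k) β (q k) t ⟩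
      (s * α + t * β) * q k           ≡⟨ cong (_* q k) sα+tβ≡1 ⟩
      1ℤ * q k                        ≡⟨ ℤP.*-identityˡ (q k) ⟩
      q k                             ∎
      where
      regroup : ∀ r w t D α → r * (t * D) + (w * α + 0ℤ) ≡ t * (D * r) + α * w
      regroup = solve-∀
      eliminate : ∀ s α p β q t → t * (α * p + β * q) + α * (- t * p + s * q) ≡ (s * α + t * β) * q
      eliminate = solve-∀

    det-T : det₂ T ≡ D
    det-T = begin
      det₂ T                          ≡⟨ expand s t D α β ⟩
      D * (s * α + t * β)             ≡⟨ cong (D *_) sα+tβ≡1 ⟩
      D * 1ℤ                          ≡⟨ ℤP.*-identityʳ D ⟩
      D                               ∎
      where
      expand : ∀ s t D α β → s * D * α - t * D * - β ≡ D * (s * α + t * β)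
      expand = solve-∀

    1<∣detT∣ : 1 ℕ.< ∣ det₂ T ∣
    1<∣detT∣ = subst (λ d → 1 ℕ.< ∣ d ∣) (sym det-T)
                     (ℕP.≤∧≢⇒< (ℕP.n≢0⇒n>0 (D≢0 ∘ ℤP.∣i∣≡0⇒i≡0)) (∣D∣≢1 ∘ sym))

  saturated : ∀ {D A B} (r : Fin n → ℤ) → D ≢ 0ℤ → (∀ k → D * r k ≡ lin A p B q k) → InSpan X r
  saturated {D} {A} {B} r D≢0 Dr≡Ap+Bq with zero-pair? A B
  ... | inj₁ (refl , refl) = 0ℤ , 0ℤ , λ k → *-cancelˡ-0 D≢0 (Dr≡Ap+Bq k)
  ... | inj₂ A,B≢0 = divide (coprime-split A B A,B≢0)
    where
    divide : CoprimeSplit A B → InSpan X r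
    divide (g , α , β , bez-αβ , g≢0 , A≡gα , B≡gβ) = divide′ (coprime-split D g (inj₁ D≢0))
      where
      divide′ : CoprimeSplit D g → InSpan X r
      divide′ (h , D′ , g′ , bez-D′g′ , h≢0 , D≡hD′ , g≡hg′) = D′ * g′ * α , D′ * g′ * β , r≈
        where
        D′r≡g′u : ∀ k → D′ * r k ≡ g′ * lin α p β q k
        D′r≡g′u k = *-cancelˡ h≢0 (begin
          h * (D′ * r k)                          ≡⟨ sym (ℤP.*-assoc h D′ (r k)) ⟩
          h * D′ * r k                            ≡⟨ cong (_* r k) (sym D≡hD′) ⟩
          D * r k                                 ≡⟨ Dr≡Ap+Bq k ⟩
          A * p k + B * q k                       ≡⟨ cong₂ (λ a b → a * p k + b * q k) A≡gα B≡gβ ⟩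
          g * α * p k + g * β * q k               ≡⟨ cong (λ c → c * α * p k + c * β * q k) g≡hg′ ⟩
          h * g′ * α * p k + h * g′ * β * q k     ≡⟨ factor h g′ α (p k) β (q k) ⟩
          h * (g′ * lin α p β q k)                ∎)
          where
          factor : ∀ h g a x b y → h * g * a * x + h * g * b * y ≡ h * (g * (a * x + b * y))
          factor = solve-∀

        D′≢0 : D′ ≢ 0ℤ
        D′≢0 D′≡0 = D≢0 (trans D≡hD′ (trans (cong (h *_) D′≡0) (ℤP.*-zeroʳ h)))

        D′-unit : Unit D′
        D′-unit = denominator-unit bez-αβ bez-D′g′ D′≢0 D′r≡g′u

        r≈ : r ≈ lin (D′ * g′ * α) p (D′ * g′ * β) q
        r≈ k = begin
          r k                                     ≡⟨ sym (ℤP.*-identityˡ (r k)) ⟩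
          1ℤ * r k                                ≡⟨ cong (_* r k) (sym (Unit-sq D′-unit)) ⟩
          D′ * D′ * r k                           ≡⟨ ℤP.*-assoc D′ D′ (r k) ⟩
          D′ * (D′ * r k)                         ≡⟨ cong (D′ *_) (D′r≡g′u k) ⟩
          D′ * (g′ * lin α p β q k)               ≡⟨ distribute D′ g′ α (p k) β (q k) ⟩
          lin (D′ * g′ * α) p (D′ * g′ * β) q k   ∎
          where
          distribute : ∀ d g a x b y → d * (g * (a * x + b * y)) ≡ d * g * a * x + d * g * b * y
          distribute = solve-∀

normal-nonzero : (ℓ : Lattice 2) (G : Mat 3 3) (X : Mat 3 2) → congr X G ≐ gram ℓ →
  Nonzero (cross (col X 0F) (col X 1F))
normal-nonzero ℓ G X X-iso with nonzero? (cross (col X 0F) (col X 1F))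
... | inj₁ N≢0 = N≢0
... | inj₂ N≈0 = ⊥-elim (pos⇒≢0 (disc-pos ℓ) (begin
  disc₂ ℓ
    ≡⟨ det₂-cong (λ i j → sym (X-iso i j)) ⟩
  form G p p * form G q q - form G p q * form G q p
    ≡⟨ cong₂ _-_ (cong₂ _*_ (form-dot G p p) (form-dot G q q)) (cong₂ _*_ (form-dot G p q) (form-dot G q p)) ⟩
  dot p (G *ᵥ p) * dot q (G *ᵥ q) - dot p (G *ᵥ q) * dot q (G *ᵥ p)
    ≡⟨ binet-cauchy p q (G *ᵥ p) (G *ᵥ q) ⟩
  dot (cross p q) (cross (G *ᵥ p) (G *ᵥ q))
    ≡⟨ dot-zeroˡ (cross (G *ᵥ p) (G *ᵥ q)) N≈0 ⟩
  0ℤ ∎))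
  where
  p = col X 0F
  q = col X 1F

in-plane : (ℓ : Lattice 2) {G : Mat 3 3} (G-sym : Symmetric G) (X : Mat 3 2) → congr X G ≐ gram ℓ → Primitive₂ ℓ →
  ∀ r → dot r (cross (col X 0F) (col X 1F)) ≡ 0ℤ → InSpan X r
in-plane ℓ {G} G-sym X X-iso prim r r⊥N =
  Saturation.saturated ℓ G-sym X X-iso prim {A = dot (cross r q) N} {B = dot (cross p r) N} r
                       (pos⇒≢0 (dot-self-pos N (normal-nonzero ℓ G X X-iso))) λ k → begin
    dot N N * r k                                ≡⟨ cramer p q r k ⟩
    lin (dot (cross r q) N) p (dot (cross p r) N) q k + dot r N * N k
      ≡⟨ cong (λ c → lin (dot (cross r q) N) p (dot (cross p r) N) q k + c * N k) r⊥N ⟩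
    lin (dot (cross r q) N) p (dot (cross p r) N) q k + 0ℤ
      ≡⟨ ℤP.+-identityʳ _ ⟩
    lin (dot (cross r q) N) p (dot (cross p r) N) q k ∎
  where
  p = col X 0F
  q = col X 1F
  N = cross p q

module _ {n} (ℓ : Lattice 2) {G : Mat n n} (G-sym : Symmetric G) (X : Mat n 2) (X-iso : congr X G ≐ gram ℓ) where

  private
    p q : Fin n → ℤ
    p = col X 0F
    q = col X 1F

  adapted-basis : ∀ α β s t u → u ≈ lin α p β q → s * α + t * β ≡ 1ℤ → let w = lin (- t) p s q in
    IsoBin ℓ (form G u u) (form G u w) (form G w w) × PrimRep ℓ (form G u u)
  adapted-basis α β s t u u≈ sα+tβ≡1 =
    (T , inj₁ det-T , T-gram) , (α , β , Bezout⇒gcd≡1 (s , t , sα+tβ≡1) , T-gram 0F 0F)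
    where
    w = lin (- t) p s q
    T = mat₂ α (- t) β s

    det-T : det₂ T ≡ 1ℤ
    det-T = trans (expand α β s t) sα+tβ≡1
      where
      expand : ∀ α β s t → α * s - - t * β ≡ s * α + t * β
      expand = solve-∀

    XT≐uw : X *ₘ T ≐ cols₂ u w
    XT≐uw k 0F = trans (proj₁ (*ₘ-mat₂ X α (- t) β s k)) (sym (u≈ k))
    XT≐uw k 1F = proj₂ (*ₘ-mat₂ X α (- t) β s k)

    T-gram : congr T (gram ℓ) ≐ bin (form G u u) (form G u w) (form G w w)
    T-gram = congr-factor {G = G} {X₁ = X} T XT≐uw X-iso (gram-cols₂ G-sym u w)

cross-adapted : ∀ p q γ δ s t u → u ≈ lin γ p δ q → s * γ + t * δ ≡ 1ℤ → cross u (lin (- t) p s q) ≈ cross p q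
cross-adapted p q γ δ s t u u≈ sγ+tδ≡1 k = begin
  cross u (lin (- t) p s q) k                       ≡⟨ cross-cong {b = lin (- t) p s q} {b′ = lin (- t) p s q} u≈ (λ _ → refl) k ⟩
  cross (lin γ p δ q) (lin (- t) p s q) k           ≡⟨ cross-lin p q γ δ (- t) s k ⟩
  (γ * s - δ * - t) * cross p q k                   ≡⟨ cong (_* cross p q k) (trans (coefficient γ δ s t) sγ+tδ≡1) ⟩
  1ℤ * cross p q k                                  ≡⟨ ℤP.*-identityˡ (cross p q k) ⟩
  cross p q k                                       ∎
  where
  coefficient : ∀ γ δ s t → γ * s - δ * - t ≡ s * γ + t * δ
  coefficient = solve-∀

condII⇒buried₃ : (ℓ₁ ℓ₂ : Lattice 2) → CondII ℓ₁ ℓ₂ → BuriedIn 3 ℓ₁ ℓ₂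
condII⇒buried₃ ℓ₁ ℓ₂ (a , a>0 , _ , _ , b₁ , c₁ , b₂ , c₂ , iso₁ , iso₂ , z , e²<d₁d₂) =
  L , GramRep-trans {G = gram L} (IsoBin⇒GramRep {ℓ₁} iso₁) (embed (pick₂ 0F 1F) , congr-pick₂ (symm L) 0F 1F)
    , GramRep-trans {G = gram L} (IsoBin⇒GramRep {ℓ₂} iso₂) (embed (pick₂ 0F 2F) , congr-pick₂ (symm L) 0F 2F)
  where
  d₁>0 : 0ℤ < a * c₁ - b₁ * b₁
  d₁>0 = subst (0ℤ <_) (sym (IsoBin⇒disc {ℓ₁} iso₁)) (disc-pos ℓ₁)

  Δ>0 : 0ℤ < Δ a b₁ b₂ c₁ z c₂
  Δ>0 = <⇒0<- (subst₂ (λ d₁ d₂ → (a * z - b₁ * b₂) * (a * z - b₁ * b₂) < d₁ * d₂)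
                      (sym (IsoBin⇒disc {ℓ₁} iso₁)) (sym (IsoBin⇒disc {ℓ₂} iso₂)) e²<d₁d₂)

  L : Lattice 3
  L = record { gram = tern a b₁ b₂ c₁ z c₂ ; symm = tern-sym a b₁ b₂ c₁ z c₂
             ; posdef = tern-posdef a b₁ b₂ c₁ z c₂ a>0 d₁>0 Δ>0 }

module _ {ℓ₁ ℓ₂ : Lattice 2} (L : Lattice 3) (u w₁ w₂ N : V) where

  private
    G = gram L
    a b₁ c₁ b₂ c₂ z : ℤ
    a  = form G u u
    b₁ = form G u w₁
    c₁ = form G w₁ w₁
    b₂ = form G u w₂
    c₂ = form G w₂ w₂
    z  = form G w₁ w₂

  -- N is orthogonal to u and w₁ but not to w₂, so (u, w₁, w₂) is independent and its Gram matrix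
  -- is positive definite.
  common-basis⇒condII :
    IsoBin ℓ₁ (form (gram L) u u) (form (gram L) u w₁) (form (gram L) w₁ w₁) → PrimRep ℓ₁ (form (gram L) u u) →
    IsoBin ℓ₂ (form (gram L) u u) (form (gram L) u w₂) (form (gram L) w₂ w₂) → PrimRep ℓ₂ (form (gram L) u u) →
    Nonzero u → dot u N ≡ 0ℤ → dot w₁ N ≡ 0ℤ → dot w₂ N ≢ 0ℤ → CondII ℓ₁ ℓ₂
  common-basis⇒condII iso₁ rep₁ iso₂ rep₂ u≢0 u⊥N w₁⊥N w₂N≢0 =
    a , a>0 , rep₁ , rep₂ , b₁ , c₁ , b₂ , c₂ , iso₁ , iso₂ , z , e²<d₁d₂
    where
    a>0 : 0ℤ < a
    a>0 = posdef L u u≢0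

    d₁>0 : 0ℤ < a * c₁ - b₁ * b₁
    d₁>0 = subst (0ℤ <_) (sym (IsoBin⇒disc {ℓ₁} iso₁)) (disc-pos ℓ₁)

    x : Fin 3 → ℤ
    x = witness a b₁ b₂ c₁ z c₂

    Mx≢0 : Nonzero (cols₃ u w₁ w₂ *ᵥ x)
    Mx≢0 = dot≢0⇒Nonzero (cols₃ u w₁ w₂ *ᵥ x) N λ MxN≡0 →
      *-≢0 (pos⇒≢0 (*-pos a>0 d₁>0)) w₂N≢0 (trans (sym (dot-cols₃-⊥ u w₁ w₂ x N u⊥N w₁⊥N)) MxN≡0)

    Q>0 : 0ℤ < Qf (tern a b₁ b₂ c₁ z c₂) x
    Q>0 = subst (0ℤ <_) (trans (form-*ᵥ G (cols₃ u w₁ w₂) x x)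
                               (form-cong {x = x} {y = x} (gram-cols₃ (symm L) u w₁ w₂) (λ _ → refl) (λ _ → refl)))
                (posdef L (cols₃ u w₁ w₂ *ᵥ x) Mx≢0)

    e²<d₁d₂ : (a * z - b₁ * b₂) * (a * z - b₁ * b₂) < disc₂ ℓ₁ * disc₂ ℓ₂
    e²<d₁d₂ = subst₂ (λ d₁ d₂ → (a * z - b₁ * b₂) * (a * z - b₁ * b₂) < d₁ * d₂)
                     (IsoBin⇒disc {ℓ₁} iso₁) (IsoBin⇒disc {ℓ₂} iso₂) (0<-⇒< (Δ-pos a b₁ b₂ c₁ z c₂ a>0 d₁>0 Q>0))

module _ (ℓ₁ ℓ₂ : Lattice 2) (prim₁ : Primitive₂ ℓ₁) (prim₂ : Primitive₂ ℓ₂) (L : Lattice 3)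
         (X₁ X₂ : Mat 3 2) (X₁-iso : congr X₁ (gram L) ≐ gram ℓ₁) (X₂-iso : congr X₂ (gram L) ≐ gram ℓ₂) where

  private
    G = gram L
    G-sym = symm L
    p₁ q₁ p₂ q₂ N₁ N₂ v : V
    p₁ = col X₁ 0F
    q₁ = col X₁ 1F
    p₂ = col X₂ 0F
    q₂ = col X₂ 1F
    N₁ = cross p₁ q₁
    N₂ = cross p₂ q₂
    v = cross N₁ N₂

  coplanar⇒represents : v ≈ (λ _ → 0ℤ) → Represents ℓ₂ ℓ₁
  coplanar⇒represents v≈0 = Y , congr-factor {G = G} {X₁ = X₁} Y X₁Y≐X₂ X₁-iso X₂-iso
    where
    ⊥N₁ : ∀ r → dot r N₂ ≡ 0ℤ → dot r N₁ ≡ 0ℤ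
    ⊥N₁ r r⊥N₂ = *-cancelˡ-0 (pos⇒≢0 (dot-self-pos N₂ (normal-nonzero ℓ₂ G X₂ X₂-iso)))
                            (trans (ℤP.*-comm (dot N₂ N₂) (dot r N₁)) (parallel-normals N₁ N₂ r v≈0 r⊥N₂))
    span-p₂ = in-plane ℓ₁ G-sym X₁ X₁-iso prim₁ p₂ (⊥N₁ p₂ (dot-cross-selfˡ p₂ q₂))
    span-q₂ = in-plane ℓ₁ G-sym X₁ X₁-iso prim₁ q₂ (⊥N₁ q₂ (dot-cross-selfʳ p₂ q₂))
    a b c d : ℤ
    a = proj₁ span-p₂
    c = proj₁ (proj₂ span-p₂)
    b = proj₁ span-q₂
    d = proj₁ (proj₂ span-q₂)
    Y : Mat 2 2
    Y = mat₂ a b c d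
    X₁Y≐X₂ : X₁ *ₘ Y ≐ X₂
    X₁Y≐X₂ k 0F = trans (proj₁ (*ₘ-mat₂ X₁ a b c d k)) (sym (proj₂ (proj₂ span-p₂) k))
    X₁Y≐X₂ k 1F = trans (proj₂ (*ₘ-mat₂ X₁ a b c d k)) (sym (proj₂ (proj₂ span-q₂) k))

  -- u is a primitive vector of ℤ³ on the line where the planes of ℓ₁ and ℓ₂ meet.
  common-vector⇒condII : PrimitivePart v → CondII ℓ₁ ℓ₂
  common-vector⇒condII (h , u , s , h≢0 , v≈hu , us≡1) =
    common-basis⇒condII {ℓ₁} {ℓ₂} L u w₁ w₂ N₁ (proj₁ adapted₁) (proj₂ adapted₁) (proj₁ adapted₂) (proj₂ adapted₂)
      (dot≢0⇒Nonzero u s (λ us≡0 → 1≢0 (trans (sym us≡1) us≡0))) u⊥N₁ (dot-cross-lin p₁ q₁ (- t₁) s₁)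
      (λ w₂N₁≡0 → h≢0 (trans (sym w₂·N₁≡h) w₂N₁≡0))
    where
    1≢0 : 1ℤ ≢ 0ℤ
    1≢0 ()

    ⊥-from-v : ∀ N → dot v N ≡ 0ℤ → dot u N ≡ 0ℤ
    ⊥-from-v N v⊥N = *-cancelˡ-0 h≢0 (begin
      h * dot u N             ≡⟨ sym (dot-scaleˡ h u N) ⟩
      dot (λ k → h * u k) N   ≡⟨ sym (dot-cong {b = N} v≈hu (λ _ → refl)) ⟩
      dot v N                 ≡⟨ v⊥N ⟩
      0ℤ                      ∎)
    u⊥N₁ = ⊥-from-v N₁ (trans (dot-comm v N₁) (dot-cross-selfˡ N₁ N₂))
    u⊥N₂ = ⊥-from-v N₂ (trans (dot-comm v N₂) (dot-cross-selfʳ N₁ N₂))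
    span₁ = in-plane ℓ₁ G-sym X₁ X₁-iso prim₁ u u⊥N₁
    span₂ = in-plane ℓ₂ G-sym X₂ X₂-iso prim₂ u u⊥N₂
    α₁ β₁ α₂ β₂ s₁ t₁ s₂ t₂ : ℤ
    α₁ = proj₁ span₁
    β₁ = proj₁ (proj₂ span₁)
    α₂ = proj₁ span₂
    β₂ = proj₁ (proj₂ span₂)
    s₁ = dot p₁ s
    t₁ = dot q₁ s
    s₂ = dot p₂ s
    t₂ = dot q₂ s
    u≈₁ : u ≈ lin α₁ p₁ β₁ q₁
    u≈₁ = proj₂ (proj₂ span₁)
    u≈₂ : u ≈ lin α₂ p₂ β₂ q₂
    u≈₂ = proj₂ (proj₂ span₂)
    bez₁ : s₁ * α₁ + t₁ * β₁ ≡ 1ℤ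
    bez₁ = bezout-coordinates s p₁ q₁ α₁ β₁ u≈₁ us≡1
    bez₂ : s₂ * α₂ + t₂ * β₂ ≡ 1ℤ
    bez₂ = bezout-coordinates s p₂ q₂ α₂ β₂ u≈₂ us≡1
    adapted₁ = adapted-basis ℓ₁ G-sym X₁ X₁-iso α₁ β₁ s₁ t₁ u u≈₁ bez₁
    adapted₂ = adapted-basis ℓ₂ G-sym X₂ X₂-iso α₂ β₂ s₂ t₂ u u≈₂ bez₂
    w₁ w₂ : V
    w₁ = lin (- t₁) p₁ s₁ q₁
    w₂ = lin (- t₂) p₂ s₂ q₂

    N₁×u×w₂≈v : cross N₁ (cross u w₂) ≈ v
    N₁×u×w₂≈v = cross-cong {N₁} {N₁} {cross u w₂} {N₂} (λ _ → refl) (cross-adapted p₂ q₂ α₂ β₂ s₂ t₂ u u≈₂ bez₂)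

    w₂·N₁≡h : dot w₂ N₁ ≡ h
    w₂·N₁≡h = begin
      dot w₂ N₁                        ≡⟨ sym (triple-with-unit N₁ u w₂ s us≡1 u⊥N₁) ⟩
      dot (cross N₁ (cross u w₂)) s    ≡⟨ dot-cong {a = cross N₁ (cross u w₂)} {a′ = v} {b = s} {b′ = s} N₁×u×w₂≈v (λ _ → refl) ⟩
      dot v s                          ≡⟨ dot-cong {b = s} v≈hu (λ _ → refl) ⟩
      dot (λ k → h * u k) s            ≡⟨ dot-scaleˡ h u s ⟩
      h * dot u s                      ≡⟨ cong (h *_) us≡1 ⟩
      h * 1ℤ                           ≡⟨ ℤP.*-identityʳ h ⟩
      h                                ∎

  buried₃⇒condII : ¬ BuriedIn 2 ℓ₁ ℓ₂ → CondII ℓ₁ ℓ₂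
  buried₃⇒condII ¬buried₂ with nonzero? v
  ... | inj₁ v≢0 = common-vector⇒condII (primitive-part v v≢0)
  ... | inj₂ v≈0 = ⊥-elim (¬buried₂ (ℓ₁ , (I₂ , congr-embed (λ i → i) (gram ℓ₁)) , coplanar⇒represents v≈0))

theorem3p10 : (ℓ₁ ℓ₂ : Lattice 2) → Primitive₂ ℓ₁ → Primitive₂ ℓ₂ → ¬ BuriedIn 2 ℓ₁ ℓ₂ →
    ((BuriedIn 3 ℓ₁ ℓ₂ → CondII ℓ₁ ℓ₂) × (CondII ℓ₁ ℓ₂ → BuriedIn 3 ℓ₁ ℓ₂))
theorem3p10 ℓ₁ ℓ₂ prim₁ prim₂ ¬buried₂ =
  (λ { (L , (X₁ , X₁-iso) , (X₂ , X₂-iso)) → buried₃⇒condII ℓ₁ ℓ₂ prim₁ prim₂ L X₁ X₂ X₁-iso X₂-iso ¬buried₂ }) ,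
  condII⇒buried₃ ℓ₁ ℓ₂
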